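{- Let $k\ge 2$ and let $\mathcal{H}$ be a connected $k$-uniform threshold hypergraph given by a binary sequence $(b_1,\dots,b_n)_k$, with short sequence $C(a_1,\dots,a_r)_k$ and adjacency matrix $A(\mathcal{H})$. Write $S_i=a_1+\dots+a_i$ ($S_0=0$). For each $j$ with $a_j\ge 2$ one obtains an eigenvalue of $A(\mathcal{H})$ and a lower bound on its multiplicity as follows. (1) Suppose $r=2m$ (here $b_k=0$). For $1\le \ell\le m$ let $N_{2\ell}=\sum_{i=1}^{a_{2\ell}}\binom{S_{2\ell-1}-3+i}{k-3}$. (a) If $j=2t-1$ for an integer $t$, then $-\sum_{\ell=t}^{m}N_{2\ell}$ is an eigenvalue of $A(\mathcal{H})$ with multiplicity at least $a_{2t-1}-1$. (b) If $j=2t$ for an integer $t$, then $-\Big(\sum_{\ell=t+1}^{m}N_{2\ell}+\binom{S_{2t}-2}{k-2}\Big)$ is an eigenvalue of $A(\mathcal{H})$ with multiplicity at least $a_{2t}-1$. (2) Suppose $r=2m-1$ (here $b_k=1$). For $2\le \ell\le m$ let $N_{2\ell-1}=\binom{S_{2\ell-2}-2}{k-3}+\binom{S_{2\ell-2}-1}{k-3}+\dots+\binom{S_{2\ell-1}-3}{k-3}$. (a) If $j=2t-1$ for an integer $t$, then $-\Big(\sum_{\ell=t+1}^{m}N_{2\ell-1}+\binom{S_{2t-1}-2}{k-2}\Big)$ is an eigenvalue of $A(\mathcal{H})$ with multiplicity at least $a_{2t-1}-1$. (b) If $j=2t$ for an integer $t$, then $-\sum_{\ell=t+1}^{m}N_{2\ell-1}$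 is an eigenvalue of $A(\mathcal{H})$ with multiplicity at least $a_{2t}-1$.
   Context: Let $k\ge 2$ and $n$ be positive integers and let $(b_1,\dots,b_n)_k$ be a binary sequence ($b_i\in\{0,1\}$) with $b_1=\dots=b_{k-1}=0$. The $k$-uniform threshold hypergraph $\mathcal{H}=(V,E)$ given by this sequence has vertex set $V=\{v_1,\dots,v_n\}$, and a set $e$ is an edge if and only if $e$ is a $k$-element subset of $V$ and $b_j=1$, where $j=\max\{i: v_i\in e\}$. Connected has its usual hypergraph meaning (for such hypergraphs this forces $b_n=1$). The adjacency matrix $A(\mathcal{H})=(a_{i,j})$ is the $n\times n$ symmetric matrix with $a_{i,j}=|\{e\in E: v_i,v_j\in e\}|$ for $i\ne j$ and $a_{i,i}=0$. Short sequence: if $b_k=0$, $(a_1,\dots,a_r)$ are the lengths of the successive maximal runs of equal consecutive entries of $(b_1,\dots,b_n)$ (odd-indexed runs consist of zeros, even-indexed runs of ones); if $b_k=1$, $a_1$ is the total length of the first two runs (the initial $k-1$ zeros together with the following run of ones) and $a_2,\dots,a_r$ are the lengths of the subsequent maximal runs (even-indexed ones consist of zeros, odd-indexed ones with index $\ge 3$ of ones). Binomial coefficients follow the convention $\binom{a}{b}=0$ for $b<0$. -}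

module Defs where

open import Data.Bool using (Bool; true; false; if_then_else_; _∧_)
open import Data.Nat using (ℕ; zero; suc; _+_; _∸_; _≡ᵇ_)
open import Data.Nat.Combinatorics using (_C_)
open import Data.Integer as ℤ using (ℤ; +_; -[1+_])
open import Data.Fin using (Fin; zero; suc)
open import Data.Fin.Subset using (Subset; ∣_∣; _∈_)
open import Data.Vec using (Vec; []; _∷_; lookup; toList)
open import Data.List using (List; []; _∷_; _++_; map; filterᵇ; length)
open import Data.Maybe using (Maybe; just; nothing; maybe)
open import Data.Product using (Σ; _×_)
open import Data.Empty using (⊥)
open import Relation.Binary.PropositionalEquality using (_≡_)
open import Relation.Binary.Construct.Closure.ReflexiveTransitive using (Star)
open import Relation.Nullary.Decidable using (does)
open import Data.Fin using (_≟_)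
open import Data.Bool using () renaming (_≟_ to _≟B_)

-- Threshold hypergraph given by a binary sequence b = (b_1,...,b_n)
-- (stored as a Vec; vertex v_i is the Fin index i-1; true = 1, false = 0).

allSubsets : (n : ℕ) → List (Subset n)
allSubsets zero    = [] ∷ []
allSubsets (suc n) = map (true ∷_) (allSubsets n) ++ map (false ∷_) (allSubsets n)

maxElem : {n : ℕ} → Subset n → Maybe (Fin n)
maxElem []      = nothing
maxElem (x ∷ s) with maxElem s
... | just i  = just (suc i)
... | nothing = if x then just zero else nothing

isEdge : {n : ℕ} → ℕ → Vec Bool n → Subset n → Bool
isEdge k b e = (∣ e ∣ ≡ᵇ k) ∧ maybe (lookup b) false (maxElem e)

IsEdge : {n : ℕ} → ℕ → Vec Bool n → Subset n → Set
IsEdge k b e = isEdge k b e ≡ true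

memb : {n : ℕ} → Fin n → Subset n → Bool
memb i s = lookup s i

codeg : {n : ℕ} → ℕ → Vec Bool n → Fin n → Fin n → ℕ
codeg {n} k b i j =
  length (filterᵇ (λ e → isEdge k b e ∧ memb i e ∧ memb j e) (allSubsets n))

adjMatrix : {n : ℕ} → ℕ → Vec Bool n → Fin n → Fin n → ℤ
adjMatrix k b i j = if does (i ≟ j) then + 0 else + codeg k b i j

Adjacent : {n : ℕ} → ℕ → Vec Bool n → Fin n → Fin n → Set
Adjacent {n} k b u v = Σ (Subset n) λ e → IsEdge k b e × u ∈ e × v ∈ e

Connected : {n : ℕ} → ℕ → Vec Bool n → Set
Connected k b = ∀ u v → Star (Adjacent k b) u v

runsGo : Bool → ℕ → List Bool → List ℕ
runsGo c len []       = len ∷ []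
runsGo c len (x ∷ xs) = if does (x ≟B c) then runsGo c (suc len) xs else len ∷ runsGo x 1 xs

runs : List Bool → List ℕ
runs []       = []
runs (x ∷ xs) = runsGo x 1 xs

-- b_i, 1-indexed (false outside the range)
bAt : {n : ℕ} → Vec Bool n → ℕ → Bool
bAt []      _             = false
bAt (x ∷ b) zero          = false
bAt (x ∷ b) (suc zero)    = x
bAt (x ∷ b) (suc (suc i)) = bAt b (suc i)

mergeFirstTwo : List ℕ → List ℕ
mergeFirstTwo (r₁ ∷ r₂ ∷ rs) = (r₁ + r₂) ∷ rs
mergeFirstTwo rs             = rs

shortSeq : {n : ℕ} → ℕ → Vec Bool n → List ℕ
shortSeq k b = if bAt b k then mergeFirstTwo (runs (toList b)) else runs (toList b)

-- 1-indexed access a_i (0 outside the range)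
at : List ℕ → ℕ → ℕ
at []       _             = 0
at (x ∷ xs) zero          = 0
at (x ∷ xs) (suc zero)    = x
at (x ∷ xs) (suc (suc i)) = at xs (suc i)

S : List ℕ → ℕ → ℕ
S as zero    = 0
S as (suc i) = S as i + at as (suc i)

sumTo : ℕ → (ℕ → ℕ) → ℕ
sumTo zero    f = 0
sumTo (suc n) f = sumTo n f + f (suc n)

-- sumRange lo hi f = Σ_{ℓ = lo}^{hi} f ℓ  (empty if hi < lo)
sumRange : ℕ → ℕ → (ℕ → ℕ) → ℕ
sumRange lo hi f = sumTo (suc hi ∸ lo) (λ i → f (lo + i ∸ 1))

-- binomial coefficient with integer lower index, = 0 for negative lower index
choose : ℕ → ℤ → ℕ
choose a (+ b)     = a C b
choose a -[1+ _ ]  = 0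

∑ : {n : ℕ} → (Fin n → ℤ) → ℤ
∑ {zero}  f = + 0
∑ {suc n} f = f zero ℤ.+ ∑ (λ i → f (suc i))

IsEigenvector : {n : ℕ} → (Fin n → Fin n → ℤ) → ℤ → (Fin n → ℤ) → Set
IsEigenvector A λ' v = ∀ i → ∑ (λ j → A i j ℤ.* v j) ≡ λ' ℤ.* v i

LinearlyIndependent : {n d : ℕ} → (Fin d → Fin n → ℤ) → Set
LinearlyIndependent {n} {d} v =
  (c : Fin d → ℤ) → (∀ i → ∑ (λ p → c p ℤ.* v p i) ≡ + 0) → ∀ p → c p ≡ + 0

EigenvalueWithMultAtLeast : {n : ℕ} → (Fin n → Fin n → ℤ) → ℤ → ℕ → Set
EigenvalueWithMultAtLeast {n} A λ' d =
  (Σ (Fin n → ℤ) λ v → IsEigenvector A λ' v × ¬zero v)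
  × (Σ (Fin d → Fin n → ℤ) λ v → (∀ p → IsEigenvector A λ' (v p)) × LinearlyIndependent v)
  where
  ¬zero : (Fin n → ℤ) → Set
  ¬zero v = Σ (Fin n) λ i → (v i ≡ + 0 → ⊥)

-- Write F(v) = b_v C(v-2,k-2) + Σ_{p>v} b_p C(p-3,k-3). Sorting the edges through two vertices
-- v_i, v_j (i < j) by their largest vertex shows that their codegree is F(j), so the adjacency
-- matrix only depends on F at the larger index. If F is constant on a block v_{l+1}, …, v_{l+a},
-- these vertices are pairwise twins and the differences e_{l+1} - e_{l+q} (q = 2, …, a) are
-- independent eigenvectors for -F(l+a). By Pascal's rule F is constant along every run of the
-- sequence, and also across v_{k-1}, v_k when b_k = 1 (as C(k-3,k-3) = C(k-2,k-2)); this is why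
-- the short sequence merges the first two runs in that case. At the end of a run, F is the
-- binomial term (for a run of ones) plus the contributions N of the later runs of ones.

module Submission where

open import Defs
open import Data.Bool using (Bool; true; false; if_then_else_; _∧_; not; T?)
open import Data.Bool.Properties using (∧-comm; ∧-zeroʳ; ∧-identityʳ; ¬-not) renaming (_≟_ to _≟ᵇ_)
open import Data.Nat using (ℕ; zero; suc; _+_; _*_; _∸_; _≤_; _<_; z≤n; s≤s; s≤s⁻¹; _≡ᵇ_; _⊔_)
open import Data.Nat.Properties hiding (_≟_)
open import Data.Nat.Combinatorics using (_C_; nCk+nC[k+1]≡[n+1]C[k+1]; nCn≡1)
open import Data.Integer as ℤ using (ℤ; +_; -[1+_]; _-_; -_)
import Data.Integer.Properties as ℤ
open import Data.Fin using (Fin; zero; suc; toℕ; inject₁; fromℕ; fromℕ<; _≟_)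
open import Data.Fin.Properties using (toℕ-inject₁; toℕ-fromℕ; toℕ<n; toℕ-fromℕ<; toℕ-injective)
open import Data.Fin.Relation.Unary.Top using (view; ‵fromℕ; ‵inject₁)
open import Data.Fin.Subset using (Subset; ∣_∣)
open import Data.Vec using (Vec; []; _∷_; lookup; _∷ʳ_; initLast; toList)
import Data.Vec.Properties as Vec
open import Data.List using (List; []; _∷_; _++_; map; filterᵇ; length; replicate)
open import Data.List.Relation.Unary.All using (All; []; _∷_)
import Data.List.Properties as List
open import Algebra.Properties.CommutativeSemigroup +-commutativeSemigroup using (interchange)
open import Data.Integer.Tactic.RingSolver using (solve-∀)
open import Function using (_∘_; case_of_)
open import Function.Definitions using (Injective)
open import Relation.Nullary using (yes; no; does; ¬_)
open import Relation.Binary.PropositionalEquality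
open import Relation.Binary.Definitions using (tri<; tri≈; tri>)
open import Data.Empty using (⊥-elim)
open import Data.Sum using (inj₁; inj₂)
open import Data.Product using (_×_; _,_; proj₂; ∃-syntax)
open import Data.Maybe as Maybe using (just; nothing)


count : (n : ℕ) → (Subset n → Bool) → ℕ
count n P = length (filterᵇ P (allSubsets n))

length-filterᵇ-cong : {A : Set} {P Q : A → Bool} → P ≗ Q → (xs : List A) →
  length (filterᵇ P xs) ≡ length (filterᵇ Q xs)
length-filterᵇ-cong P≗Q [] = refl
length-filterᵇ-cong {Q = Q} P≗Q (x ∷ xs) rewrite P≗Q x with Q x
... | true = cong suc (length-filterᵇ-cong P≗Q xs)
... | false = length-filterᵇ-cong P≗Q xs

length-filterᵇ-map : {A B : Set} (P : B → Bool) (f : A → B) (xs : List A) →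
  length (filterᵇ P (map f xs)) ≡ length (filterᵇ (P ∘ f) xs)
length-filterᵇ-map P f [] = refl
length-filterᵇ-map P f (x ∷ xs) with P (f x)
... | true = cong suc (length-filterᵇ-map P f xs)
... | false = length-filterᵇ-map P f xs

count-cong : ∀ {n} {P Q : Subset n → Bool} → P ≗ Q → count n P ≡ count n Q
count-cong {n} P≗Q = length-filterᵇ-cong P≗Q (allSubsets n)

count-∷ : ∀ n (P : Subset (suc n) → Bool) →
  count (suc n) P ≡ count n (P ∘ (true ∷_)) + count n (P ∘ (false ∷_))
count-∷ n P = begin
  length (filterᵇ P (map (true ∷_) es ++ map (false ∷_) es))
    ≡⟨ cong length (List.filter-++ (T? ∘ P) (map (true ∷_) es) _) ⟩
  length (filterᵇ P (map (true ∷_) es) ++ filterᵇ P (map (false ∷_) es))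
    ≡⟨ List.length-++ (filterᵇ P (map (true ∷_) es)) ⟩
  length (filterᵇ P (map (true ∷_) es)) + length (filterᵇ P (map (false ∷_) es))
    ≡⟨ cong₂ _+_ (length-filterᵇ-map P (true ∷_) es) (length-filterᵇ-map P (false ∷_) es) ⟩
  count n (P ∘ (true ∷_)) + count n (P ∘ (false ∷_)) ∎
  where
  open ≡-Reasoning
  es : List (Subset n)
  es = allSubsets n

count-∷ʳ : ∀ n (P : Subset (suc n) → Bool) →
  count (suc n) P ≡ count n (P ∘ (_∷ʳ true)) + count n (P ∘ (_∷ʳ false))
count-∷ʳ zero P = trans (count-∷ zero P) (cong₂ _+_ (count-cong cons≗snoc) (count-cong cons≗snoc))
  where
  cons≗snoc : ∀ {x} → (λ e → P (x ∷ e)) ≗ (λ e → P (e ∷ʳ x))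
  cons≗snoc [] = refl
count-∷ʳ (suc n) P = begin
  count (suc (suc n)) P
    ≡⟨ count-∷ (suc n) P ⟩
  count (suc n) (P ∘ (true ∷_)) + count (suc n) (P ∘ (false ∷_))
    ≡⟨ cong₂ _+_ (count-∷ʳ n (P ∘ (true ∷_))) (count-∷ʳ n (P ∘ (false ∷_))) ⟩
  (c true true + c true false) + (c false true + c false false)
    ≡⟨ interchange (c true true) (c true false) (c false true) (c false false) ⟩
  (c true true + c false true) + (c true false + c false false)
    ≡⟨ sym (cong₂ _+_ (count-∷ n (P ∘ (_∷ʳ true))) (count-∷ n (P ∘ (_∷ʳ false)))) ⟩
  count (suc n) (P ∘ (_∷ʳ true)) + count (suc n) (P ∘ (_∷ʳ false)) ∎
  where
  open ≡-Reasoning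
  c : Bool → Bool → ℕ
  c x y = count n (λ e → P (x ∷ (e ∷ʳ y)))

count-none : ∀ n {P : Subset n → Bool} → (∀ e → P e ≡ false) → count n P ≡ 0
count-none zero P≡false rewrite P≡false [] = refl
count-none (suc n) P≡false = trans (count-∷ n _)
  (cong₂ _+_ (count-none n (P≡false ∘ (true ∷_))) (count-none n (P≡false ∘ (false ∷_))))

count-guarded : ∀ n (P Q : Subset n → Bool) c →
  count n (λ e → (P e ∧ c) ∧ Q e) ≡ (if c then count n (λ e → P e ∧ Q e) else 0)
count-guarded n P Q true = count-cong (λ e → cong (_∧ Q e) (∧-identityʳ (P e)))
count-guarded n P Q false = count-none n (λ e → cong (_∧ Q e) (∧-zeroʳ (P e)))

choose-pascal : ∀ n z → choose n (ℤ.pred z) + choose n z ≡ choose (suc n) z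
choose-pascal n (+ zero) = refl
choose-pascal n (+ suc j) = nCk+nC[k+1]≡[n+1]C[k+1] n j
choose-pascal n -[1+ j ] = refl

count-size : ∀ n j → count n (λ e → ∣ e ∣ ≡ᵇ j) ≡ n C j
count-size zero zero = refl
count-size zero (suc j) = refl
count-size (suc n) zero = trans (count-∷ n _) (cong₂ _+_ (count-none n (λ _ → refl)) (count-size n zero))
count-size (suc n) (suc j) = trans (count-∷ n _)
  (trans (cong₂ _+_ (count-size n j) (count-size n (suc j))) (nCk+nC[k+1]≡[n+1]C[k+1] n j))

count-size-∋ : ∀ n j (u : Fin (suc n)) →
  count (suc n) (λ e → (∣ e ∣ ≡ᵇ j) ∧ memb u e) ≡ choose n (+ j - + 1)
count-size-∋ n zero zero =
  trans (count-∷ n _) (cong₂ _+_ (count-none n (λ _ → refl)) (count-none n (λ _ → ∧-zeroʳ _)))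
count-size-∋ n (suc j) zero = trans (count-∷ n _)
  (trans (cong₂ _+_ (trans (count-cong {n} (λ _ → ∧-identityʳ _)) (count-size n j))
                    (count-none n (λ _ → ∧-zeroʳ _)))
         (+-identityʳ _))
count-size-∋ (suc n) zero (suc u) =
  trans (count-∷ (suc n) _) (cong₂ _+_ (count-none (suc n) (λ _ → refl)) (count-size-∋ n zero u))
count-size-∋ (suc n) (suc j) (suc u) = trans (count-∷ (suc n) _)
  (trans (cong₂ _+_ (count-size-∋ n j u) (count-size-∋ n (suc j) u)) (choose-pascal n (+ j)))

count-size-∋₀∋ : ∀ n j (w : Fin (suc n)) →
  count (suc (suc n)) (λ e → (∣ e ∣ ≡ᵇ j) ∧ (memb zero e ∧ memb (suc w) e)) ≡ choose n (+ j - + 2)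
count-size-∋₀∋ n zero w =
  trans (count-∷ (suc n) _) (cong₂ _+_ (count-none (suc n) (λ _ → refl)) (count-none (suc n) (λ _ → ∧-zeroʳ _)))
count-size-∋₀∋ n (suc j) w = trans (count-∷ (suc n) _)
  (trans (cong₂ _+_ (count-size-∋ n j w) (count-none (suc n) (λ _ → ∧-zeroʳ _)))
  (trans (+-identityʳ _) (cong (choose n) (sym (ℤ.[1+m]⊖[1+n]≡m⊖n j 1)))))

count-size-∋∋ : ∀ n j (u w : Fin n) → u ≢ w →
  count n (λ e → (∣ e ∣ ≡ᵇ j) ∧ (memb u e ∧ memb w e)) ≡ choose (n ∸ 2) (+ j - + 2)
count-size-∋∋ (suc n) j zero zero u≢w = ⊥-elim (u≢w refl)
count-size-∋∋ (suc (suc n)) j zero (suc w) _ = count-size-∋₀∋ n j w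
count-size-∋∋ (suc (suc n)) j (suc u) zero _ =
  trans (count-cong (λ e → cong ((∣ e ∣ ≡ᵇ j) ∧_) (∧-comm (memb (suc u) e) (memb zero e))))
        (count-size-∋₀∋ n j u)
count-size-∋∋ (suc (suc n)) zero (suc u) (suc w) u≢w = trans (count-∷ (suc n) _)
  (cong₂ _+_ (count-none (suc n) (λ _ → refl)) (count-size-∋∋ (suc n) zero u w (u≢w ∘ cong suc)))
count-size-∋∋ (suc (suc zero)) (suc j) (suc zero) (suc zero) u≢w = ⊥-elim (u≢w refl)
count-size-∋∋ (suc (suc (suc n))) (suc j) (suc u) (suc w) u≢w = trans (count-∷ (suc (suc n)) _)
  (trans (cong₂ _+_ (count-size-∋∋ (suc (suc n)) j u w (u≢w ∘ cong suc))
                    (count-size-∋∋ (suc (suc n)) (suc j) u w (u≢w ∘ cong suc)))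
  (trans (cong (λ z → choose n z + choose n (+ suc j - + 2)) (ℤ.pred-+ (+ suc j) (- + 2)))
         (choose-pascal n (+ suc j - + 2))))


sumTo-cong : ∀ m {f g : ℕ → ℕ} → (∀ i → 1 ≤ i → i ≤ m → f i ≡ g i) → sumTo m f ≡ sumTo m g
sumTo-cong zero f≡g = refl
sumTo-cong (suc m) f≡g =
  cong₂ _+_ (sumTo-cong m (λ i 1≤i i≤m → f≡g i 1≤i (m≤n⇒m≤1+n i≤m))) (f≡g (suc m) (s≤s z≤n) ≤-refl)

sumTo-+ : ∀ m l (f : ℕ → ℕ) → sumTo (m + l) f ≡ sumTo m f + sumTo l (λ i → f (m + i))
sumTo-+ m zero f = trans (cong (λ x → sumTo x f) (+-identityʳ m)) (sym (+-identityʳ _))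
sumTo-+ m (suc l) f = begin
  sumTo (m + suc l) f                                  ≡⟨ cong (λ x → sumTo x f) (+-suc m l) ⟩
  sumTo (m + l) f + f (suc (m + l))                    ≡⟨ cong₂ _+_ (sumTo-+ m l f) (cong f (sym (+-suc m l))) ⟩
  sumTo m f + sumTo l (λ i → f (m + i)) + f (m + suc l) ≡⟨ +-assoc (sumTo m f) _ _ ⟩
  sumTo m f + sumTo (suc l) (λ i → f (m + i))          ∎
  where open ≡-Reasoning

sumTo-if : ∀ m c (f : ℕ → ℕ) → sumTo m (λ i → if c then f i else 0) ≡ (if c then sumTo m f else 0)
sumTo-if zero true f = refl
sumTo-if zero false f = refl
sumTo-if (suc m) true f = cong (_+ f (suc m)) (sumTo-if m true f)
sumTo-if (suc m) false f = cong (_+ 0) (sumTo-if m false f)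

telescope : (T N : ℕ → ℕ) → (∀ t → T t ≡ N t + T (suc t)) →
  ∀ t d → T t ≡ sumTo d (λ i → N (t + i ∸ 1)) + T (t + d)
telescope T N step t zero = cong T (sym (+-identityʳ t))
telescope T N step t (suc d) = begin
  T t                                         ≡⟨ telescope T N step t d ⟩
  sumTo d N′ + T (t + d)                      ≡⟨ cong (λ s → sumTo d N′ + s) (step (t + d)) ⟩
  sumTo d N′ + (N (t + d) + T (suc (t + d)))  ≡⟨ sym (+-assoc (sumTo d N′) _ _) ⟩
  sumTo d N′ + N (t + d) + T (suc (t + d))    ≡⟨ cong₂ (λ x y → sumTo d N′ + N x + T y) t+d≡ (sym (+-suc t d)) ⟩
  sumTo d N′ + N (t + suc d ∸ 1) + T (t + suc d) ∎
  where
  open ≡-Reasoning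
  N′ : ℕ → ℕ
  N′ i = N (t + i ∸ 1)
  t+d≡ : t + d ≡ t + suc d ∸ 1
  t+d≡ = sym (cong (_∸ 1) (+-suc t d))

sumRange-telescope : ∀ {m} (T N : ℕ → ℕ) → (∀ t → T t ≡ N t + T (suc t)) → T (suc m) ≡ 0 →
  ∀ t → t ≤ suc m → T t ≡ sumRange t m N
sumRange-telescope {m} T N step end t t≤1+m = begin
  T t                                   ≡⟨ telescope T N step t (suc m ∸ t) ⟩
  sumRange t m N + T (t + (suc m ∸ t))  ≡⟨ cong (λ s → sumRange t m N + T s) (m+[n∸m]≡n t≤1+m) ⟩
  sumRange t m N + T (suc m)            ≡⟨ cong (λ s → sumRange t m N + s) end ⟩
  sumRange t m N + 0                    ≡⟨ +-identityʳ _ ⟩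
  sumRange t m N                        ∎
  where open ≡-Reasoning

sumRange-cong : ∀ lo hi {f g : ℕ → ℕ} → (∀ ℓ → lo ≤ ℓ → f ℓ ≡ g ℓ) → sumRange lo hi f ≡ sumRange lo hi g
sumRange-cong lo hi f≡g = sumTo-cong (suc hi ∸ lo) (λ i 1≤i _ → f≡g (lo + i ∸ 1)
  (subst (lo ≤_) (sym (+-∸-assoc lo 1≤i)) (m≤m+n lo (i ∸ 1))))


-- The codegree of a pair depends only on its larger vertex

lookup-∷ʳ-last : ∀ {A : Set} {n} (xs : Vec A n) x → lookup (xs ∷ʳ x) (fromℕ n) ≡ x
lookup-∷ʳ-last [] x = refl
lookup-∷ʳ-last (_ ∷ xs) x = lookup-∷ʳ-last xs x

lookup-∷ʳ-inject₁ : ∀ {A : Set} {n} (xs : Vec A n) x i → lookup (xs ∷ʳ x) (inject₁ i) ≡ lookup xs i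
lookup-∷ʳ-inject₁ (_ ∷ xs) x zero = refl
lookup-∷ʳ-inject₁ (_ ∷ xs) x (suc i) = lookup-∷ʳ-inject₁ xs x i

∣∣-∷ʳ-true : ∀ {n} (e : Subset n) → ∣ e ∷ʳ true ∣ ≡ suc ∣ e ∣
∣∣-∷ʳ-true [] = refl
∣∣-∷ʳ-true (true ∷ e) = cong suc (∣∣-∷ʳ-true e)
∣∣-∷ʳ-true (false ∷ e) = ∣∣-∷ʳ-true e

∣∣-∷ʳ-false : ∀ {n} (e : Subset n) → ∣ e ∷ʳ false ∣ ≡ ∣ e ∣
∣∣-∷ʳ-false [] = refl
∣∣-∷ʳ-false (true ∷ e) = cong suc (∣∣-∷ʳ-false e)
∣∣-∷ʳ-false (false ∷ e) = ∣∣-∷ʳ-false e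

maxElem-∷ʳ-true : ∀ {n} (e : Subset n) → maxElem (e ∷ʳ true) ≡ just (fromℕ n)
maxElem-∷ʳ-true [] = refl
maxElem-∷ʳ-true (x ∷ e) rewrite maxElem-∷ʳ-true e = refl

maxElem-∷ʳ-false : ∀ {n} (e : Subset n) → maxElem (e ∷ʳ false) ≡ Maybe.map inject₁ (maxElem e)
maxElem-∷ʳ-false [] = refl
maxElem-∷ʳ-false (x ∷ e) rewrite maxElem-∷ʳ-false e with maxElem e
... | just i = refl
... | nothing with x
...   | true = refl
...   | false = refl

isEdge-∷ʳ-true : ∀ k {n} (b : Vec Bool n) c (e : Subset n) →
  isEdge (suc k) (b ∷ʳ c) (e ∷ʳ true) ≡ (∣ e ∣ ≡ᵇ k) ∧ c
isEdge-∷ʳ-true k b c e rewrite ∣∣-∷ʳ-true e | maxElem-∷ʳ-true e | lookup-∷ʳ-last b c = refl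

isEdge-∷ʳ-false : ∀ k {n} (b : Vec Bool n) c (e : Subset n) →
  isEdge k (b ∷ʳ c) (e ∷ʳ false) ≡ isEdge k b e
isEdge-∷ʳ-false k b c e rewrite ∣∣-∷ʳ-false e | maxElem-∷ʳ-false e with maxElem e
... | just i = cong ((∣ e ∣ ≡ᵇ k) ∧_) (lookup-∷ʳ-inject₁ b c i)
... | nothing = refl

bAt-∷ʳ-≤ : ∀ {n} (b : Vec Bool n) c p → p ≤ n → bAt (b ∷ʳ c) p ≡ bAt b p
bAt-∷ʳ-≤ [] c zero _ = refl
bAt-∷ʳ-≤ (x ∷ b) c zero _ = refl
bAt-∷ʳ-≤ (x ∷ b) c (suc zero) _ = refl
bAt-∷ʳ-≤ (x ∷ b) c (suc (suc p)) (s≤s p≤n) = bAt-∷ʳ-≤ b c (suc p) p≤n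

bAt-∷ʳ-last : ∀ {n} (b : Vec Bool n) c → bAt (b ∷ʳ c) (suc n) ≡ c
bAt-∷ʳ-last [] c = refl
bAt-∷ʳ-last (x ∷ b) c = bAt-∷ʳ-last b c

apexCount : ℕ → ℕ → ℕ
apexCount k p = choose (p ∸ 3) (+ k - + 3)

apexWeight : ∀ {n} → ℕ → Vec Bool n → ℕ → ℕ
apexWeight k b p = if bAt b p then apexCount k p else 0

codegAbove : ∀ {n} → ℕ → Vec Bool n → ℕ → ℕ
codegAbove {n} k b v = sumTo (n ∸ v) (λ i → apexWeight k b (v + i))

codegProfile : ∀ {n} → ℕ → Vec Bool n → ℕ → ℕ
codegProfile k b v = (if bAt b v then (v ∸ 2) C (k ∸ 2) else 0) + codegAbove k b v

codegAbove-top : ∀ k {n} (b : Vec Bool n) → codegAbove k b n ≡ 0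
codegAbove-top k {n} b rewrite n∸n≡0 n = refl

codegAbove-∷ʳ : ∀ k {n} (b : Vec Bool n) c v → v ≤ n →
  codegAbove k (b ∷ʳ c) v ≡ codegAbove k b v + (if c then apexCount k (suc n) else 0)
codegAbove-∷ʳ k {n} b c v v≤n = begin
  sumTo (suc n ∸ v) (weight (b ∷ʳ c))
    ≡⟨ cong (λ m → sumTo m (weight (b ∷ʳ c))) (+-∸-assoc 1 v≤n) ⟩
  sumTo (n ∸ v) (weight (b ∷ʳ c)) + weight (b ∷ʳ c) (suc (n ∸ v))
    ≡⟨ cong₂ _+_ (sumTo-cong (n ∸ v) λ i _ i≤ → cong (λ x → if x then apexCount k (v + i) else 0)
                   (bAt-∷ʳ-≤ b c (v + i) (≤-trans (+-monoʳ-≤ v i≤) (≤-reflexive (m+[n∸m]≡n v≤n)))))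
                 (cong (λ p → if bAt (b ∷ʳ c) p then apexCount k p else 0) v+[n∸v+1]≡n+1) ⟩
  codegAbove k b v + (if bAt (b ∷ʳ c) (suc n) then apexCount k (suc n) else 0)
    ≡⟨ cong (λ x → codegAbove k b v + (if x then apexCount k (suc n) else 0)) (bAt-∷ʳ-last b c) ⟩
  codegAbove k b v + (if c then apexCount k (suc n) else 0) ∎
  where
  open ≡-Reasoning
  weight : ∀ {m} → Vec Bool m → ℕ → ℕ
  weight b′ i = apexWeight k b′ (v + i)
  v+[n∸v+1]≡n+1 : v + suc (n ∸ v) ≡ suc n
  v+[n∸v+1]≡n+1 = trans (+-suc v (n ∸ v)) (cong suc (m+[n∸m]≡n v≤n))

codegProfile-∷ʳ : ∀ k {n} (b : Vec Bool n) c v → v ≤ n →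
  codegProfile k (b ∷ʳ c) v ≡ codegProfile k b v + (if c then apexCount k (suc n) else 0)
codegProfile-∷ʳ k b c v v≤n rewrite bAt-∷ʳ-≤ b c v v≤n | codegAbove-∷ʳ k b c v v≤n =
  sym (+-assoc (if bAt b v then (v ∸ 2) C (k ∸ 2) else 0) _ _)

codegProfile-last : ∀ k {n} (b : Vec Bool n) c →
  codegProfile (suc (suc k)) (b ∷ʳ c) (suc n) ≡ (if c then (n ∸ 1) C k else 0)
codegProfile-last k b c rewrite bAt-∷ʳ-last b c | codegAbove-top (suc (suc k)) (b ∷ʳ c) = +-identityʳ _

Through : ∀ {n} → ℕ → Vec Bool n → Fin n → Fin n → Subset n → Bool
Through k b u w e = isEdge k b e ∧ (memb u e ∧ memb w e)

Through-∷ʳ-true : ∀ k {n} (b : Vec Bool n) c u w (e : Subset n) →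
  Through (suc k) (b ∷ʳ c) u w (e ∷ʳ true) ≡ ((∣ e ∣ ≡ᵇ k) ∧ c) ∧ (memb u (e ∷ʳ true) ∧ memb w (e ∷ʳ true))
Through-∷ʳ-true k b c u w e = cong (_∧ _) (isEdge-∷ʳ-true k b c e)

codeg-∷ʳ-inject₁ : ∀ k {n} (b : Vec Bool n) c (u w : Fin n) → u ≢ w →
  codeg (suc (suc k)) (b ∷ʳ c) (inject₁ u) (inject₁ w)
    ≡ (if c then apexCount (suc (suc k)) (suc n) else 0) + codeg (suc (suc k)) b u w
codeg-∷ʳ-inject₁ k {n} b c u w u≢w = begin
  codeg K (b ∷ʳ c) (inject₁ u) (inject₁ w)
    ≡⟨ count-∷ʳ n _ ⟩
  count n (λ e → Through K (b ∷ʳ c) (inject₁ u) (inject₁ w) (e ∷ʳ true)) +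
  count n (λ e → Through K (b ∷ʳ c) (inject₁ u) (inject₁ w) (e ∷ʳ false))
    ≡⟨ cong₂ _+_ (count-cong throughLast) (count-cong avoidLast) ⟩
  count n (λ e → ((∣ e ∣ ≡ᵇ suc k) ∧ c) ∧ (memb u e ∧ memb w e)) + codeg K b u w
    ≡⟨ cong (_+ codeg K b u w) (count-guarded n (λ e → ∣ e ∣ ≡ᵇ suc k) (λ e → memb u e ∧ memb w e) c) ⟩
  (if c then count n (λ e → (∣ e ∣ ≡ᵇ suc k) ∧ (memb u e ∧ memb w e)) else 0) + codeg K b u w
    ≡⟨ cong (λ x → (if c then x else 0) + codeg K b u w) (trans (count-size-∋∋ n (suc k) u w u≢w) apex) ⟩
  (if c then apexCount K (suc n) else 0) + codeg K b u w ∎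
  where
  open ≡-Reasoning
  K : ℕ
  K = suc (suc k)
  throughLast : ∀ e → Through K (b ∷ʳ c) (inject₁ u) (inject₁ w) (e ∷ʳ true)
                    ≡ ((∣ e ∣ ≡ᵇ suc k) ∧ c) ∧ (memb u e ∧ memb w e)
  throughLast e = trans (Through-∷ʳ-true (suc k) b c (inject₁ u) (inject₁ w) e)
    (cong (((∣ e ∣ ≡ᵇ suc k) ∧ c) ∧_) (cong₂ _∧_ (lookup-∷ʳ-inject₁ e true u) (lookup-∷ʳ-inject₁ e true w)))
  avoidLast : ∀ e → Through K (b ∷ʳ c) (inject₁ u) (inject₁ w) (e ∷ʳ false) ≡ Through K b u w e
  avoidLast e = cong₂ _∧_ (isEdge-∷ʳ-false K b c e)
                          (cong₂ _∧_ (lookup-∷ʳ-inject₁ e false u) (lookup-∷ʳ-inject₁ e false w))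
  apex : choose (n ∸ 2) (+ suc k - + 2) ≡ apexCount K (suc n)
  apex = cong (choose (n ∸ 2)) (sym (ℤ.[1+m]⊖[1+n]≡m⊖n (suc k) 2))

codeg-∷ʳ-last : ∀ k {n} (b : Vec Bool n) c (u : Fin n) →
  codeg (suc (suc k)) (b ∷ʳ c) (inject₁ u) (fromℕ n) ≡ (if c then (n ∸ 1) C k else 0)
codeg-∷ʳ-last k {suc n} b c u = begin
  codeg K (b ∷ʳ c) (inject₁ u) (fromℕ (suc n))
    ≡⟨ count-∷ʳ (suc n) _ ⟩
  count (suc n) (λ e → Through K (b ∷ʳ c) (inject₁ u) (fromℕ (suc n)) (e ∷ʳ true)) +
  count (suc n) (λ e → Through K (b ∷ʳ c) (inject₁ u) (fromℕ (suc n)) (e ∷ʳ false))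
    ≡⟨ cong₂ _+_ (count-cong throughLast) (count-none (suc n) avoidLast) ⟩
  count (suc n) (λ e → ((∣ e ∣ ≡ᵇ suc k) ∧ c) ∧ memb u e) + 0
    ≡⟨ +-identityʳ _ ⟩
  count (suc n) (λ e → ((∣ e ∣ ≡ᵇ suc k) ∧ c) ∧ memb u e)
    ≡⟨ count-guarded (suc n) (λ e → ∣ e ∣ ≡ᵇ suc k) (memb u) c ⟩
  (if c then count (suc n) (λ e → (∣ e ∣ ≡ᵇ suc k) ∧ memb u e) else 0)
    ≡⟨ cong (λ x → if c then x else 0) (count-size-∋ n (suc k) u) ⟩
  (if c then n C k else 0) ∎
  where
  open ≡-Reasoning
  K : ℕ
  K = suc (suc k)
  throughLast : ∀ e → Through K (b ∷ʳ c) (inject₁ u) (fromℕ (suc n)) (e ∷ʳ true)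
                    ≡ ((∣ e ∣ ≡ᵇ suc k) ∧ c) ∧ memb u e
  throughLast e = trans (Through-∷ʳ-true (suc k) b c (inject₁ u) (fromℕ (suc n)) e)
    (cong (((∣ e ∣ ≡ᵇ suc k) ∧ c) ∧_)
          (trans (cong₂ _∧_ (lookup-∷ʳ-inject₁ e true u) (lookup-∷ʳ-last e true)) (∧-identityʳ (memb u e))))
  avoidLast : ∀ e → Through K (b ∷ʳ c) (inject₁ u) (fromℕ (suc n)) (e ∷ʳ false) ≡ false
  avoidLast e rewrite lookup-∷ʳ-last e false =
    trans (cong (isEdge K (b ∷ʳ c) (e ∷ʳ false) ∧_) (∧-zeroʳ (memb (inject₁ u) (e ∷ʳ false)))) (∧-zeroʳ _)

codeg-sym : ∀ k {n} (b : Vec Bool n) u w → codeg k b u w ≡ codeg k b w u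
codeg-sym k b u w = count-cong (λ e → cong (isEdge k b e ∧_) (∧-comm (memb u e) (memb w e)))

codeg-last≡codegProfile : ∀ k {n} (b : Vec Bool n) c (u : Fin n) →
  codeg (suc (suc k)) (b ∷ʳ c) (inject₁ u) (fromℕ n)
    ≡ codegProfile (suc (suc k)) (b ∷ʳ c) (suc (toℕ (inject₁ u) ⊔ toℕ (fromℕ n)))
codeg-last≡codegProfile k {n} b c u = begin
  codeg K (b ∷ʳ c) (inject₁ u) (fromℕ n)    ≡⟨ codeg-∷ʳ-last k b c u ⟩
  (if c then (n ∸ 1) C k else 0)            ≡⟨ sym (codegProfile-last k b c) ⟩
  codegProfile K (b ∷ʳ c) (suc n)           ≡⟨ cong (codegProfile K (b ∷ʳ c) ∘ suc) (sym u⊔n≡n) ⟩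
  codegProfile K (b ∷ʳ c) (suc (toℕ (inject₁ u) ⊔ toℕ (fromℕ n))) ∎
  where
  open ≡-Reasoning
  K : ℕ
  K = suc (suc k)
  u⊔n≡n : toℕ (inject₁ u) ⊔ toℕ (fromℕ n) ≡ n
  u⊔n≡n rewrite toℕ-inject₁ u | toℕ-fromℕ n = m≤n⇒m⊔n≡n (<⇒≤ (toℕ<n u))

codeg≡codegProfile : ∀ k {n} (b : Vec Bool n) (u w : Fin n) → u ≢ w →
  codeg (suc (suc k)) b u w ≡ codegProfile (suc (suc k)) b (suc (toℕ u ⊔ toℕ w))
codeg≡codegProfile k {suc n} b u w u≢w with initLast b | view u | view w
... | b′ , c , refl | ‵inject₁ u′ | ‵inject₁ w′ = begin
  codeg K (b′ ∷ʳ c) (inject₁ u′) (inject₁ w′) ≡⟨ codeg-∷ʳ-inject₁ k b′ c u′ w′ u′≢w′ ⟩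
  top + codeg K b′ u′ w′                      ≡⟨ cong (λ x → top + x) (codeg≡codegProfile k b′ u′ w′ u′≢w′) ⟩
  top + codegProfile K b′ v                   ≡⟨ +-comm top _ ⟩
  codegProfile K b′ v + top                   ≡⟨ sym (codegProfile-∷ʳ K b′ c v (⊔-lub (toℕ<n u′) (toℕ<n w′))) ⟩
  codegProfile K (b′ ∷ʳ c) v                  ≡⟨ cong (λ x → codegProfile K (b′ ∷ʳ c) (suc x))
                                                      (sym (cong₂ _⊔_ (toℕ-inject₁ u′) (toℕ-inject₁ w′))) ⟩
  codegProfile K (b′ ∷ʳ c) (suc (toℕ (inject₁ u′) ⊔ toℕ (inject₁ w′))) ∎
  where
  open ≡-Reasoning
  K : ℕ
  K = suc (suc k)
  u′≢w′ : u′ ≢ w′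
  u′≢w′ = u≢w ∘ cong inject₁
  v : ℕ
  v = suc (toℕ u′ ⊔ toℕ w′)
  top : ℕ
  top = if c then apexCount K (suc n) else 0
... | b′ , c , refl | ‵inject₁ u′ | ‵fromℕ = codeg-last≡codegProfile k b′ c u′
... | b′ , c , refl | ‵fromℕ | ‵inject₁ w′ =
  trans (codeg-sym _ (b′ ∷ʳ c) _ _)
        (trans (codeg-last≡codegProfile k b′ c w′)
               (cong (codegProfile (suc (suc k)) (b′ ∷ʳ c) ∘ suc) (⊔-comm (toℕ (inject₁ w′)) (toℕ (fromℕ n)))))
... | _ , _ , refl | ‵fromℕ | ‵fromℕ = ⊥-elim (u≢w refl)


-- Pascal steps of the codegree profile

codegProfile-on : ∀ k {n} (b : Vec Bool n) {v} → bAt b v ≡ true →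
  codegProfile k b v ≡ (v ∸ 2) C (k ∸ 2) + codegAbove k b v
codegProfile-on k b on rewrite on = refl

codegProfile-off : ∀ k {n} (b : Vec Bool n) {v} → bAt b v ≡ false → codegProfile k b v ≡ codegAbove k b v
codegProfile-off k b off rewrite off = refl

codegAbove-split : ∀ k {n} (b : Vec Bool n) v m → v + m ≤ n →
  codegAbove k b v ≡ sumTo m (λ i → apexWeight k b (v + i)) + codegAbove k b (v + m)
codegAbove-split k {n} b v m v+m≤n = begin
  sumTo (n ∸ v) weight                                          ≡⟨ cong (λ l → sumTo l weight) n∸v≡m+rest ⟩
  sumTo (m + (n ∸ (v + m))) weight                              ≡⟨ sumTo-+ m (n ∸ (v + m)) weight ⟩
  sumTo m weight + sumTo (n ∸ (v + m)) (λ i → weight (m + i))   ≡⟨ cong (λ s → sumTo m weight + s) shift ⟩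
  sumTo m weight + codegAbove k b (v + m)                       ∎
  where
  open ≡-Reasoning
  weight : ℕ → ℕ
  weight i = apexWeight k b (v + i)
  shift : sumTo (n ∸ (v + m)) (λ i → weight (m + i)) ≡ codegAbove k b (v + m)
  shift = sumTo-cong (n ∸ (v + m)) (λ i _ _ → cong (apexWeight k b) (sym (+-assoc v m i)))
  n∸v≡m+rest : n ∸ v ≡ m + (n ∸ (v + m))
  n∸v≡m+rest = begin
    n ∸ v                               ≡⟨ cong (_∸ v) (sym (m+[n∸m]≡n v+m≤n)) ⟩
    (v + m + (n ∸ (v + m))) ∸ v         ≡⟨ cong (_∸ v) (+-assoc v m _) ⟩
    (v + (m + (n ∸ (v + m)))) ∸ v       ≡⟨ m+n∸m≡n v _ ⟩
    m + (n ∸ (v + m))                   ∎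

codegAbove-step : ∀ k {n} (b : Vec Bool n) z → z < n →
  codegAbove k b z ≡ apexWeight k b (suc z) + codegAbove k b (suc z)
codegAbove-step k {n} b z z<n = trans (codegAbove-split k b z 1 (subst (_≤ n) (+-comm 1 z) z<n))
  (cong₂ _+_ (cong (apexWeight k b) (+-comm z 1)) (cong (codegAbove k b) (+-comm z 1)))

apexCount-pascal : ∀ k n → n C k + apexCount (suc (suc k)) (suc (suc (suc n))) ≡ suc n C k
apexCount-pascal k n = begin
  n C k + choose n (suc (suc k) ℤ.⊖ 3)
    ≡⟨ cong (λ z → n C k + choose n z) (trans (ℤ.[1+m]⊖[1+n]≡m⊖n (suc k) 2) (ℤ.[1+m]⊖[1+n]≡m⊖n k 1)) ⟩
  n C k + choose n (ℤ.pred (+ k))  ≡⟨ +-comm (n C k) _ ⟩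
  choose n (ℤ.pred (+ k)) + n C k  ≡⟨ choose-pascal n (+ k) ⟩
  suc n C k                        ∎
  where open ≡-Reasoning

codegProfile-step-inRun : ∀ k {n} (b : Vec Bool n) z → 2 ≤ z → z < n → bAt b z ≡ bAt b (suc z) →
  codegProfile (suc (suc k)) b z ≡ codegProfile (suc (suc k)) b (suc z)
codegProfile-step-inRun k b (suc zero) (s≤s ()) _ _
codegProfile-step-inRun k b z@(suc (suc z′)) _ z<n same = begin
  top z + codegAbove K b z                                  ≡⟨ cong (λ s → top z + s) (codegAbove-step K b z z<n) ⟩
  top z + (apexWeight K b (suc z) + codegAbove K b (suc z)) ≡⟨ sym (+-assoc (top z) _ _) ⟩
  top z + apexWeight K b (suc z) + codegAbove K b (suc z)   ≡⟨ cong (_+ codegAbove K b (suc z)) (pascal _ _ same) ⟩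
  top (suc z) + codegAbove K b (suc z)                      ∎
  where
  open ≡-Reasoning
  K : ℕ
  K = suc (suc k)
  top : ℕ → ℕ
  top v = if bAt b v then (v ∸ 2) C k else 0
  pascal : ∀ x y → x ≡ y → (if x then z′ C k else 0) + (if y then apexCount K (suc z) else 0)
                          ≡ (if y then suc z′ C k else 0)
  pascal true .true refl = apexCount-pascal k z′
  pascal false .false refl = refl

codegProfile-step-threshold : ∀ k {n} (b : Vec Bool n) → 2 + k < n →
  bAt b (2 + k) ≡ false → bAt b (3 + k) ≡ true → codegProfile (3 + k) b (2 + k) ≡ codegProfile (3 + k) b (3 + k)
codegProfile-step-threshold k b 2+k<n off on rewrite off | codegAbove-step (3 + k) b (2 + k) 2+k<n | on =
  cong (_+ codegAbove (3 + k) b (3 + k)) (trans (nCn≡1 k) (sym (nCn≡1 (suc k))))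


-- Eigenvectors from twin vertices

δ : ∀ {n} → Fin n → Fin n → ℤ
δ x j = if does (x ≟ j) then + 1 else + 0

δ-refl : ∀ {n} (x : Fin n) → δ x x ≡ + 1
δ-refl x with x ≟ x
... | yes _ = refl
... | no x≢x = ⊥-elim (x≢x refl)

δ-sym : ∀ {n} (x y : Fin n) → δ x y ≡ δ y x
δ-sym x y with x ≟ y | y ≟ x
... | yes _ | yes _ = refl
... | no _ | no _ = refl
... | yes x≡y | no y≢x = ⊥-elim (y≢x (sym x≡y))
... | no x≢y | yes y≡x = ⊥-elim (x≢y (sym y≡x))

δ-injective : ∀ {d n} {f : Fin d → Fin n} → Injective _≡_ _≡_ f → ∀ p q → δ (f p) (f q) ≡ δ p q
δ-injective {f = f} f-inj p q with f p ≟ f q | p ≟ q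
... | yes _ | yes _ = refl
... | no _ | no _ = refl
... | yes fp≡fq | no p≢q = ⊥-elim (p≢q (f-inj fp≡fq))
... | no fp≢fq | yes p≡q = ⊥-elim (fp≢fq (cong f p≡q))

δ-≢ : ∀ {n} {x y : Fin n} → x ≢ y → δ x y ≡ + 0
δ-≢ {x = x} {y} x≢y with x ≟ y
... | yes x≡y = ⊥-elim (x≢y x≡y)
... | no _ = refl

∑-cong : ∀ {n} {f g : Fin n → ℤ} → f ≗ g → ∑ f ≡ ∑ g
∑-cong {zero} f≗g = refl
∑-cong {suc n} f≗g = cong₂ ℤ._+_ (f≗g zero) (∑-cong (f≗g ∘ suc))

∑-zero : ∀ n → ∑ {n} (λ _ → + 0) ≡ + 0
∑-zero zero = refl
∑-zero (suc n) = cong (λ s → + 0 ℤ.+ s) (∑-zero n)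

∑-*δ : ∀ {n} (f : Fin n → ℤ) x → ∑ (λ j → f j ℤ.* δ x j) ≡ f x
∑-*δ {suc n} f zero = begin
  f zero ℤ.* + 1 ℤ.+ ∑ (λ j → f (suc j) ℤ.* + 0)
    ≡⟨ cong₂ ℤ._+_ (ℤ.*-identityʳ (f zero)) (trans (∑-cong (ℤ.*-zeroʳ ∘ f ∘ suc)) (∑-zero n)) ⟩
  f zero ℤ.+ + 0 ≡⟨ ℤ.+-identityʳ (f zero) ⟩
  f zero ∎
  where open ≡-Reasoning
∑-*δ {suc n} f (suc x) =
  trans (cong₂ ℤ._+_ (ℤ.*-zeroʳ (f zero)) (∑-*δ (f ∘ suc) x)) (ℤ.+-identityˡ (f (suc x)))

∑-neg : ∀ {n} (f : Fin n → ℤ) → ∑ (λ j → - f j) ≡ - ∑ f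
∑-neg {zero} f = refl
∑-neg {suc n} f = trans (cong (λ s → - f zero ℤ.+ s) (∑-neg (f ∘ suc))) (sym (ℤ.neg-distrib-+ (f zero) (∑ (f ∘ suc))))

∑-sub : ∀ {n} (f g : Fin n → ℤ) → ∑ (λ j → f j - g j) ≡ ∑ f - ∑ g
∑-sub {zero} f g = refl
∑-sub {suc n} f g = trans (cong (λ s → f zero - g zero ℤ.+ s) (∑-sub (f ∘ suc) (g ∘ suc)))
                          (interchange-sub (f zero) (g zero) (∑ (f ∘ suc)) (∑ (g ∘ suc)))
  where
  interchange-sub : ∀ a b c d → (a - b) ℤ.+ (c - d) ≡ (a ℤ.+ c) - (b ℤ.+ d)
  interchange-sub = solve-∀

record Twins {n} (M : Fin n → Fin n → ℤ) (V : ℤ) (x y : Fin n) : Set where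
  field
    distinct : x ≢ y
    diagˡ : M x x ≡ + 0
    diagʳ : M y y ≡ + 0
    joinˡ : M x y ≡ V
    joinʳ : M y x ≡ V
    alike : ∀ i → i ≢ x → i ≢ y → M i x ≡ M i y

twins-eigenvector : ∀ {n} {M : Fin n → Fin n → ℤ} {V x y} → Twins M V x y →
  IsEigenvector M (- V) (λ j → δ x j - δ y j)
twins-eigenvector {M = M} {V} {x} {y} twins i = begin
  ∑ (λ j → M i j ℤ.* (δ x j - δ y j))
    ≡⟨ ∑-cong (λ j → distrib (M i j) (δ x j) (δ y j)) ⟩
  ∑ (λ j → M i j ℤ.* δ x j - M i j ℤ.* δ y j)
    ≡⟨ ∑-sub (λ j → M i j ℤ.* δ x j) (λ j → M i j ℤ.* δ y j) ⟩
  ∑ (λ j → M i j ℤ.* δ x j) - ∑ (λ j → M i j ℤ.* δ y j)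
    ≡⟨ cong₂ _-_ (∑-*δ (M i) x) (∑-*δ (M i) y) ⟩
  M i x - M i y
    ≡⟨ row ⟩
  - V ℤ.* (δ x i - δ y i) ∎
  where
  open ≡-Reasoning
  open Twins twins
  distrib : ∀ m a b → m ℤ.* (a - b) ≡ m ℤ.* a - m ℤ.* b
  distrib = solve-∀
  row : M i x - M i y ≡ - V ℤ.* (δ x i - δ y i)
  row with x ≟ i | y ≟ i
  ... | yes refl | yes refl = ⊥-elim (distinct refl)
  ... | yes refl | no _ rewrite diagˡ | joinˡ = atˡ V
    where
    atˡ : ∀ v → + 0 - v ≡ - v ℤ.* (+ 1 - + 0)
    atˡ = solve-∀
  ... | no _ | yes refl rewrite joinʳ | diagʳ = atʳ V
    where
    atʳ : ∀ v → v - + 0 ≡ - v ℤ.* (+ 0 - + 1)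
    atʳ = solve-∀
  ... | no x≢i | no y≢i rewrite alike i (x≢i ∘ sym) (y≢i ∘ sym) = elsewhere (M i y) V
    where
    elsewhere : ∀ m v → m - m ≡ - v ℤ.* (+ 0 - + 0)
    elsewhere = solve-∀

differences-linearlyIndependent : ∀ {d n} (x : Fin n) (ys : Fin d → Fin n) → Injective _≡_ _≡_ ys →
  (∀ p → x ≢ ys p) → LinearlyIndependent (λ p j → δ x j - δ (ys p) j)
differences-linearlyIndependent x ys ys-inj x∉ys c vanishes q = ℤ.neg-injective (begin
  - c q                                             ≡⟨ cong -_ (sym (∑-*δ c q)) ⟩
  - ∑ (λ p → c p ℤ.* δ q p)                         ≡⟨ sym (∑-neg (λ p → c p ℤ.* δ q p)) ⟩
  ∑ (λ p → - (c p ℤ.* δ q p))                       ≡⟨ ∑-cong coefficient ⟩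
  ∑ (λ p → c p ℤ.* (δ x (ys q) - δ (ys p) (ys q)))  ≡⟨ vanishes (ys q) ⟩
  + 0                                               ∎)
  where
  open ≡-Reasoning
  coefficient : ∀ p → - (c p ℤ.* δ q p) ≡ c p ℤ.* (δ x (ys q) - δ (ys p) (ys q))
  coefficient p rewrite δ-≢ (x∉ys q) | δ-injective ys-inj p q | δ-sym p q = negate (c p) (δ q p)
    where
    negate : ∀ a e → - (a ℤ.* e) ≡ a ℤ.* (+ 0 - e)
    negate = solve-∀

twinClass-eigenvalue : ∀ {d n} {M : Fin n → Fin n → ℤ} {V} (x : Fin n) (ys : Fin d → Fin n) →
  Fin d → Injective _≡_ _≡_ ys → (∀ p → Twins M V x (ys p)) →
  EigenvalueWithMultAtLeast M (- V) d
twinClass-eigenvalue {d} {n} x ys p₀ ys-inj twins =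
  (difference p₀ , twins-eigenvector (twins p₀) , x , nonzero) ,
  (difference , twins-eigenvector ∘ twins ,
   differences-linearlyIndependent x ys ys-inj (Twins.distinct ∘ twins))
  where
  difference : Fin d → Fin n → ℤ
  difference p j = δ x j - δ (ys p) j
  nonzero : difference p₀ x ≢ + 0
  nonzero rewrite δ-refl x | δ-≢ (Twins.distinct (twins p₀) ∘ sym) = λ ()

stepwise-constant : (f : ℕ → ℕ) (lo hi : ℕ) → (∀ z → lo < z → z < hi → 2 ≤ z → f z ≡ f (suc z)) →
  ∀ p → lo < p → p ≤ hi → 2 ≤ p → f p ≡ f hi
stepwise-constant f lo zero _ (suc p) _ () _
stepwise-constant f lo (suc hi) step p lo<p p≤1+hi 2≤p with m≤n⇒m<n∨m≡n p≤1+hi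
... | inj₂ refl = refl
... | inj₁ (s≤s p≤hi) =
  trans (stepwise-constant f lo hi (λ z lo<z z<hi → step z lo<z (m≤n⇒m≤1+n z<hi)) p lo<p p≤hi 2≤p)
        (step hi (<-≤-trans lo<p p≤hi) ≤-refl (≤-trans 2≤p p≤hi))

-- Vertex i is v_{toℕ i + 1}: f is evaluated at the 1-based index of the larger vertex.
IsMaxProfile : ∀ {n} → (Fin n → Fin n → ℤ) → (ℕ → ℕ) → Set
IsMaxProfile M f = (∀ i → M i i ≡ + 0) × (∀ i j → i ≢ j → M i j ≡ + f (suc (toℕ i ⊔ toℕ j)))

1≤⊔ : ∀ {n} {i j : Fin n} → i ≢ j → 1 ≤ toℕ i ⊔ toℕ j
1≤⊔ {i = zero} {zero} i≢j = ⊥-elim (i≢j refl)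
1≤⊔ {i = zero} {suc j} _ = s≤s z≤n
1≤⊔ {i = suc i} {j} _ = ≤-trans (s≤s z≤n) (m≤m⊔n (suc (toℕ i)) (toℕ j))

InBlock : ∀ {n} → ℕ → ℕ → Fin n → Set
InBlock lo hi x = lo ≤ toℕ x × toℕ x < hi

maxProfile-twins : ∀ {n} {M : Fin n → Fin n → ℤ} {f} → IsMaxProfile M f →
  ∀ lo hi V → (∀ p → lo < p → p ≤ hi → 2 ≤ p → f p ≡ V) →
  ∀ {x y} → InBlock lo hi x → InBlock lo hi y → x ≢ y → Twins M (+ V) x y
maxProfile-twins {M = M} {f} (diag , offDiag) lo hi V constant {x} {y} x∈ y∈ x≢y = record
  { distinct = x≢y ; diagˡ = diag x ; diagʳ = diag y
  ; joinˡ = entry x y x≢y (proj₂ x∈) y∈ ; joinʳ = entry y x (x≢y ∘ sym) (proj₂ y∈) x∈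
  ; alike = alike }
  where
  entry : ∀ i z → i ≢ z → toℕ i < hi → InBlock lo hi z → M i z ≡ + V
  entry i z i≢z i<hi (lo≤z , z<hi) = trans (offDiag i z i≢z) (cong +_
    (constant _ (s≤s (≤-trans lo≤z (m≤n⊔m (toℕ i) (toℕ z)))) (⊔-lub i<hi z<hi) (s≤s (1≤⊔ i≢z))))
  alike : ∀ i → i ≢ x → i ≢ y → M i x ≡ M i y
  alike i i≢x i≢y with toℕ i <? hi
  ... | yes i<hi = trans (entry i x i≢x i<hi x∈) (sym (entry i y i≢y i<hi y∈))
  ... | no i≮hi = begin
    M i x                        ≡⟨ offDiag i x i≢x ⟩
    + f (suc (toℕ i ⊔ toℕ x))    ≡⟨ cong (λ m → + f (suc m)) (m≥n⇒m⊔n≡m (below x∈)) ⟩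
    + f (suc (toℕ i))            ≡⟨ cong (λ m → + f (suc m)) (sym (m≥n⇒m⊔n≡m (below y∈))) ⟩
    + f (suc (toℕ i ⊔ toℕ y))    ≡⟨ sym (offDiag i y i≢y) ⟩
    M i y                        ∎
    where
    open ≡-Reasoning
    below : ∀ {z} → InBlock lo hi z → toℕ z ≤ toℕ i
    below (_ , z<hi) = <⇒≤ (<-≤-trans z<hi (≮⇒≥ i≮hi))

maxProfile-eigenvalue : ∀ {n} {M : Fin n → Fin n → ℤ} {f} → IsMaxProfile M f →
  ∀ lo a → 2 ≤ a → lo + a ≤ n → (∀ z → lo < z → z < lo + a → 2 ≤ z → f z ≡ f (suc z)) →
  EigenvalueWithMultAtLeast M (- + f (lo + a)) (a ∸ 1)
maxProfile-eigenvalue _ lo (suc zero) (s≤s ()) _ _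
maxProfile-eigenvalue {n} {M} {f} maxProfile lo a@(suc (suc a′)) _ lo+a≤n step =
  twinClass-eigenvalue first later zero later-injective (λ p →
    maxProfile-twins maxProfile lo (lo + a) (f (lo + a)) (stepwise-constant f lo (lo + a) step)
                     first∈block (later∈block p) (first≢later p))
  where
  position : ∀ m → m < a → lo + m < n
  position m m<a = <-≤-trans (+-monoʳ-< lo m<a) lo+a≤n
  first : Fin n
  first = fromℕ< (position 0 (s≤s z≤n))
  later : Fin (suc a′) → Fin n
  later p = fromℕ< (position (suc (toℕ p)) (s≤s (toℕ<n p)))
  toℕ-first : toℕ first ≡ lo + 0
  toℕ-first = toℕ-fromℕ< (position 0 (s≤s z≤n))
  toℕ-later : ∀ p → toℕ (later p) ≡ lo + suc (toℕ p)
  toℕ-later p = toℕ-fromℕ< (position (suc (toℕ p)) (s≤s (toℕ<n p)))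
  first∈block : InBlock lo (lo + a) first
  first∈block rewrite toℕ-first = m≤m+n lo 0 , +-monoʳ-< lo (s≤s z≤n)
  later∈block : ∀ p → InBlock lo (lo + a) (later p)
  later∈block p rewrite toℕ-later p = m≤m+n lo _ , +-monoʳ-< lo (s≤s (toℕ<n p))
  first≢later : ∀ p → first ≢ later p
  first≢later p eq = 0≢1+n (+-cancelˡ-≡ lo 0 (suc (toℕ p))
    (trans (sym toℕ-first) (trans (cong toℕ eq) (toℕ-later p))))
  later-injective : Injective _≡_ _≡_ later
  later-injective {p} {q} eq = toℕ-injective (suc-injective (+-cancelˡ-≡ lo _ _
    (trans (sym (toℕ-later p)) (trans (cong toℕ eq) (toℕ-later q)))))

adjMatrix-isMaxProfile : ∀ k {n} (b : Vec Bool n) →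
  IsMaxProfile (adjMatrix (suc (suc k)) b) (codegProfile (suc (suc k)) b)
adjMatrix-isMaxProfile k b = diag , offDiag
  where
  diag : ∀ i → adjMatrix (suc (suc k)) b i i ≡ + 0
  diag i with i ≟ i
  ... | yes _ = refl
  ... | no i≢i = ⊥-elim (i≢i refl)
  offDiag : ∀ i j → i ≢ j →
    adjMatrix (suc (suc k)) b i j ≡ + codegProfile (suc (suc k)) b (suc (toℕ i ⊔ toℕ j))
  offDiag i j i≢j with i ≟ j
  ... | yes i≡j = ⊥-elim (i≢j i≡j)
  ... | no _ = cong +_ (codeg≡codegProfile k b i j i≢j)


-- Runs of the binary sequence

runColour : Bool → ℕ → Bool
runColour c zero = c
runColour c (suc j) = runColour (not c) j

fromRuns : Bool → List ℕ → List Bool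
fromRuns c [] = []
fromRuns c (a ∷ as) = replicate a c ++ fromRuns (not c) as

replicate-∷ʳ : ∀ {A : Set} len (c : A) xs → replicate (suc len) c ++ xs ≡ replicate len c ++ (c ∷ xs)
replicate-∷ʳ zero c xs = refl
replicate-∷ʳ (suc len) c xs = cong (c ∷_) (replicate-∷ʳ len c xs)

fromRuns-runsGo : ∀ c len xs → fromRuns c (runsGo c len xs) ≡ replicate len c ++ xs
fromRuns-runsGo c len [] = refl
fromRuns-runsGo c len (x ∷ xs) with x ≟ᵇ c
... | yes refl = trans (fromRuns-runsGo c (suc len) xs) (replicate-∷ʳ len c xs)
... | no x≢c rewrite ¬-not x≢c = cong (replicate len c ++_) (fromRuns-runsGo (not c) 1 xs)

runsGo-positive : ∀ c len xs → 1 ≤ len → All (1 ≤_) (runsGo c len xs)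
runsGo-positive c len [] 1≤len = 1≤len ∷ []
runsGo-positive c len (x ∷ xs) 1≤len with x ≟ᵇ c
... | yes _ = runsGo-positive c (suc len) xs (s≤s z≤n)
... | no _ = 1≤len ∷ runsGo-positive x 1 xs (s≤s z≤n)

runs-fromRuns : ∀ {n} (b : Vec Bool n) → bAt b 1 ≡ false → toList b ≡ fromRuns false (runs (toList b))
runs-fromRuns [] _ = refl
runs-fromRuns (false ∷ b) _ = sym (fromRuns-runsGo false 1 (toList b))

runs-positive : ∀ xs → All (1 ≤_) (runs xs)
runs-positive [] = []
runs-positive (x ∷ xs) = runsGo-positive x 1 xs (s≤s z≤n)

bitAt : List Bool → ℕ → Bool
bitAt [] _ = false
bitAt (x ∷ xs) zero = false
bitAt (x ∷ xs) (suc zero) = x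
bitAt (x ∷ xs) (suc (suc i)) = bitAt xs (suc i)

bAt≡bitAt : ∀ {n} (b : Vec Bool n) p → bAt b p ≡ bitAt (toList b) p
bAt≡bitAt [] p = refl
bAt≡bitAt (x ∷ b) zero = refl
bAt≡bitAt (x ∷ b) (suc zero) = refl
bAt≡bitAt (x ∷ b) (suc (suc p)) = bAt≡bitAt b (suc p)

bitAt-++ʳ : ∀ xs ys i → bitAt (xs ++ ys) (suc (length xs + i)) ≡ bitAt ys (suc i)
bitAt-++ʳ [] ys i = refl
bitAt-++ʳ (x ∷ xs) ys i = bitAt-++ʳ xs ys i

bitAt-replicate : ∀ a (c : Bool) ys i → i < a → bitAt (replicate a c ++ ys) (suc i) ≡ c
bitAt-replicate (suc a) c ys zero _ = refl
bitAt-replicate (suc a) c ys (suc i) (s≤s i<a) = bitAt-replicate a c ys i i<a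

S-∷ : ∀ a rs j → S (a ∷ rs) (suc j) ≡ a + S rs j
S-∷ a rs zero = sym (+-identityʳ a)
S-∷ a rs (suc j) = trans (cong (_+ at rs (suc j)) (S-∷ a rs j)) (+-assoc a (S rs j) _)

bitAt-fromRuns : ∀ c rs j p → S rs j < p → p ≤ S rs (suc j) → bitAt (fromRuns c rs) p ≡ runColour c j
bitAt-fromRuns c [] j p Sj<p p≤Sj+0 = ⊥-elim (<⇒≱ Sj<p (≤-trans p≤Sj+0 (≤-reflexive (+-identityʳ (S [] j)))))
bitAt-fromRuns c (a ∷ rs) zero (suc i) _ i<a = bitAt-replicate a c _ i i<a
bitAt-fromRuns c (a ∷ rs) (suc j) p Sj<p p≤S1+j = begin
  bitAt bits p                                  ≡⟨ cong (bitAt bits) p≡1+a+i ⟩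
  bitAt bits (suc (a + i))                      ≡⟨ cong (λ l → bitAt bits (suc (l + i))) (sym (List.length-replicate a)) ⟩
  bitAt bits (suc (length (replicate a c) + i)) ≡⟨ bitAt-++ʳ (replicate a c) _ i ⟩
  bitAt (fromRuns (not c) rs) (suc i)
    ≡⟨ bitAt-fromRuns (not c) rs j (suc i) (+-cancelˡ-< a _ _ a+Sj<a+1+i) (+-cancelˡ-≤ a _ _ a+1+i≤a+S1+j) ⟩
  runColour (not c) j ∎
  where
  open ≡-Reasoning
  bits : List Bool
  bits = replicate a c ++ fromRuns (not c) rs
  a<p : a < p
  a<p = ≤-<-trans (m≤m+n a (S rs j)) (subst (_< p) (S-∷ a rs j) Sj<p)
  i : ℕ
  i = p ∸ suc a
  p≡1+a+i : p ≡ suc (a + i)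
  p≡1+a+i = sym (m+[n∸m]≡n a<p)
  a+Sj<a+1+i : a + S rs j < a + suc i
  a+Sj<a+1+i = subst₂ _<_ (S-∷ a rs j) (trans p≡1+a+i (sym (+-suc a i))) Sj<p
  a+1+i≤a+S1+j : a + suc i ≤ a + S rs (suc j)
  a+1+i≤a+S1+j = subst₂ _≤_ (trans p≡1+a+i (sym (+-suc a i))) (S-∷ a rs (suc j)) p≤S1+j

length-fromRuns : ∀ c rs → length (fromRuns c rs) ≡ S rs (length rs)
length-fromRuns c [] = refl
length-fromRuns c (a ∷ rs) = begin
  length (replicate a c ++ fromRuns (not c) rs)   ≡⟨ List.length-++ (replicate a c) ⟩
  length (replicate a c) + length (fromRuns (not c) rs) ≡⟨ cong₂ _+_ (List.length-replicate a) (length-fromRuns (not c) rs) ⟩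
  a + S rs (length rs)                            ≡⟨ sym (S-∷ a rs (length rs)) ⟩
  S (a ∷ rs) (suc (length rs))                    ∎
  where open ≡-Reasoning

S-beyond : ∀ rs j → length rs ≤ j → S rs j ≡ S rs (length rs)
S-beyond [] zero _ = refl
S-beyond [] (suc j) _ = trans (+-identityʳ (S [] j)) (S-beyond [] j z≤n)
S-beyond (a ∷ rs) (suc j) (s≤s len≤j) =
  trans (S-∷ a rs j) (trans (cong (λ s → a + s) (S-beyond rs j len≤j)) (sym (S-∷ a rs (length rs))))

S-≤-total : ∀ rs j → S rs j ≤ S rs (length rs)
S-≤-total [] j = ≤-reflexive (S-beyond [] j z≤n)
S-≤-total (a ∷ rs) zero = z≤n
S-≤-total (a ∷ rs) (suc j) =
  subst₂ _≤_ (sym (S-∷ a rs j)) (sym (S-∷ a rs (length rs))) (+-monoʳ-≤ a (S-≤-total rs j))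

at-zero : ∀ rs → at rs 0 ≡ 0
at-zero [] = refl
at-zero (_ ∷ _) = refl

¬1≤at-zero : ∀ rs → ¬ (1 ≤ at rs 0)
¬1≤at-zero [] ()
¬1≤at-zero (_ ∷ _) ()

All-at : ∀ {rs} → All (1 ≤_) rs → ∀ j → j < length rs → 1 ≤ at rs (suc j)
All-at (1≤r ∷ _) zero _ = 1≤r
All-at (_ ∷ 1≤rs) (suc j) (s≤s j<len) = All-at 1≤rs j j<len

bAt-beyond : ∀ {n} (b : Vec Bool n) p → n < p → bAt b p ≡ false
bAt-beyond [] p _ = refl
bAt-beyond (x ∷ b) (suc zero) (s≤s ())
bAt-beyond (x ∷ b) (suc (suc p)) (s≤s n<1+p) = bAt-beyond b (suc p) n<1+p

-- The paper's N_i: the contribution to F of the i-th run, when it is a run of ones.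
runSum : ℕ → List ℕ → ℕ → ℕ
runSum k rs i = sumTo (at rs i) (λ q → apexCount k (S rs (i ∸ 1) + q))

2*-suc : ∀ t → 2 * suc t ≡ suc (suc (2 * t))
2*-suc t = *-suc 2 t

2*∸1-suc : ∀ t → 2 * suc t ∸ 1 ≡ suc (2 * t)
2*∸1-suc t = cong (_∸ 1) (2*-suc t)

suc-2*∸1 : ∀ t → 1 ≤ t → suc (2 * t ∸ 1) ≡ 2 * t
suc-2*∸1 (suc t) _ = trans (cong suc (2*∸1-suc t)) (sym (2*-suc t))

2≤2*∸1 : ∀ t → 2 ≤ t → 2 ≤ 2 * t ∸ 1
2≤2*∸1 (suc t) (s≤s 1≤t) = subst (2 ≤_) (sym (2*∸1-suc t)) (s≤s (≤-trans 1≤t (m≤m+n t (t + 0))))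

2*≢1+2* : ∀ a b → 2 * a ≢ suc (2 * b)
2*≢1+2* (suc a) zero 2+2a≡1 = 0≢1+n (sym (suc-injective (trans (sym (2*-suc a)) 2+2a≡1)))
2*≢1+2* (suc a) (suc b) eq =
  2*≢1+2* a b (suc-injective (suc-injective (trans (sym (2*-suc a)) (trans eq (cong suc (2*-suc b))))))

runColour-double : ∀ c t → runColour c (2 * t) ≡ c
runColour-double c zero = refl
runColour-double false (suc t) = trans (cong (runColour false) (2*-suc t)) (runColour-double false t)
runColour-double true (suc t) = trans (cong (runColour true) (2*-suc t)) (runColour-double true t)

runColour-false≡true : ∀ j → runColour false j ≡ true → ∃[ M ] suc j ≡ 2 * M
runColour-false≡true (suc zero) _ = 1 , refl
runColour-false≡true (suc (suc j)) colour with runColour-false≡true j colour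
... | M , 1+j≡2M = suc M , trans (cong (λ i → suc (suc i)) 1+j≡2M) (sym (2*-suc M))


-- The eigenvalue of each run

-- rs are the runs of b, starting with a run of zeros, and the hypergraph is K-uniform with K = k + 2.
-- Run j (counted from 0) occupies the positions S rs j + 1, …, S rs (suc j).
module RunDecomposition (k : ℕ) {n} (b : Vec Bool n) (rs : List ℕ) (b≡rs : toList b ≡ fromRuns false rs) where

  K : ℕ
  K = suc (suc k)

  S-total : S rs (length rs) ≡ n
  S-total = trans (sym (length-fromRuns false rs)) (trans (cong length (sym b≡rs)) (Vec.length-toList b))

  S≤n : ∀ j → S rs j ≤ n
  S≤n j = subst (S rs j ≤_) S-total (S-≤-total rs j)

  bAt-run : ∀ j p → S rs j < p → p ≤ S rs (suc j) → bAt b p ≡ runColour false j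
  bAt-run j p Sj<p p≤S1+j =
    trans (bAt≡bitAt b p) (trans (cong (λ bs → bitAt bs p) b≡rs) (bitAt-fromRuns false rs j p Sj<p p≤S1+j))

  bAt-runEnd : ∀ j → 1 ≤ at rs (suc j) → bAt b (S rs (suc j)) ≡ runColour false j
  bAt-runEnd j 1≤a = bAt-run j (S rs (suc j)) (m<m+n (S rs j) 1≤a) ≤-refl

  codegAbove-run : ∀ j → codegAbove K b (S rs j)
    ≡ (if runColour false j then runSum K rs (suc j) else 0) + codegAbove K b (S rs (suc j))
  codegAbove-run j = trans (codegAbove-split K b (S rs j) (at rs (suc j)) (S≤n (suc j)))
    (cong (_+ codegAbove K b (S rs (suc j)))
          (trans (sumTo-cong (at rs (suc j)) onRun)
                 (sumTo-if (at rs (suc j)) (runColour false j) (λ q → apexCount K (S rs j + q)))))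
    where
    onRun : ∀ i → 1 ≤ i → i ≤ at rs (suc j) →
      apexWeight K b (S rs j + i) ≡ (if runColour false j then apexCount K (S rs j + i) else 0)
    onRun i 1≤i i≤a = cong (λ c → if c then apexCount K (S rs j + i) else 0)
      (bAt-run j (S rs j + i) (m<m+n (S rs j) 1≤i) (+-monoʳ-≤ (S rs j) i≤a))

  N-even : ℕ → ℕ
  N-even ℓ = runSum K rs (2 * ℓ)

  codegAboveOddRun : ℕ → ℕ
  codegAboveOddRun t = codegAbove K b (S rs (2 * t ∸ 1))

  codegAboveOddRun-suc : ∀ t → codegAboveOddRun (suc t) ≡ codegAbove K b (S rs (suc (2 * t)))
  codegAboveOddRun-suc t = cong (codegAbove K b ∘ S rs) (2*∸1-suc t)

  codegAbove-skipZeroRun : ∀ t → codegAbove K b (S rs (2 * t)) ≡ codegAbove K b (S rs (suc (2 * t)))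
  codegAbove-skipZeroRun t rewrite codegAbove-run (2 * t) | runColour-double false t = refl

  codegAboveOddRun-step : ∀ t → codegAboveOddRun t ≡ N-even t + codegAboveOddRun (suc t)
  codegAboveOddRun-step zero =
    trans (codegAbove-run 0) (cong (λ a → sumTo a (apexCount K) + codegAboveOddRun 1) (sym (at-zero rs)))
  codegAboveOddRun-step (suc t) = begin
    codegAboveOddRun (suc t)
      ≡⟨ codegAboveOddRun-suc t ⟩
    codegAbove K b (S rs (suc (2 * t)))
      ≡⟨ codegAbove-run (suc (2 * t)) ⟩
    (if runColour true (2 * t) then runSum K rs (suc (suc (2 * t))) else 0) + codegAbove K b (S rs (suc (suc (2 * t))))
      ≡⟨ cong₂ (λ c s → (if c then runSum K rs (suc (suc (2 * t))) else 0) + s)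
               (runColour-double true t) (cong (codegAbove K b ∘ S rs) (sym (2*-suc t))) ⟩
    runSum K rs (suc (suc (2 * t))) + codegAbove K b (S rs (2 * suc t))
      ≡⟨ cong₂ _+_ (cong (runSum K rs) (sym (2*-suc t)))
                   (trans (codegAbove-skipZeroRun (suc t)) (sym (codegAboveOddRun-suc (suc t)))) ⟩
    N-even (suc t) + codegAboveOddRun (suc (suc t))
      ∎
    where open ≡-Reasoning

  codegAboveOddRun≡sumRange : ∀ m → length rs ≤ 2 * m → ∀ t → t ≤ suc m → codegAboveOddRun t ≡ sumRange t m N-even
  codegAboveOddRun≡sumRange m len≤2m = sumRange-telescope codegAboveOddRun N-even codegAboveOddRun-step (begin
    codegAboveOddRun (suc m)              ≡⟨ codegAboveOddRun-suc m ⟩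
    codegAbove K b (S rs (suc (2 * m)))   ≡⟨ cong (codegAbove K b) (S-beyond rs (suc (2 * m)) (m≤n⇒m≤1+n len≤2m)) ⟩
    codegAbove K b (S rs (length rs))     ≡⟨ cong (codegAbove K b) S-total ⟩
    codegAbove K b n                      ≡⟨ codegAbove-top K b ⟩
    0                                     ∎)
    where open ≡-Reasoning

  codegProfile-oddRunEnd : ∀ m → length rs ≤ 2 * m → ∀ t → t ≤ suc m → 1 ≤ at rs (2 * t ∸ 1) →
    codegProfile K b (S rs (2 * t ∸ 1)) ≡ sumRange t m N-even
  codegProfile-oddRunEnd m len≤2m zero _ 1≤a = ⊥-elim (¬1≤at-zero rs 1≤a)
  codegProfile-oddRunEnd m len≤2m (suc t) t≤1+m 1≤a = begin
    codegProfile K b (S rs (2 * suc t ∸ 1))  ≡⟨ codegProfile-off K b off ⟩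
    codegAboveOddRun (suc t)                 ≡⟨ codegAboveOddRun≡sumRange m len≤2m (suc t) t≤1+m ⟩
    sumRange (suc t) m N-even                ∎
    where
    open ≡-Reasoning
    off : bAt b (S rs (2 * suc t ∸ 1)) ≡ false
    off = begin
      bAt b (S rs (2 * suc t ∸ 1))   ≡⟨ cong (bAt b ∘ S rs) (2*∸1-suc t) ⟩
      bAt b (S rs (suc (2 * t)))     ≡⟨ bAt-runEnd (2 * t) (subst (λ i → 1 ≤ at rs i) (2*∸1-suc t) 1≤a) ⟩
      runColour false (2 * t)        ≡⟨ runColour-double false t ⟩
      false                          ∎

  codegProfile-evenRunEnd : ∀ m → length rs ≤ 2 * m → ∀ t → t ≤ m → 1 ≤ at rs (2 * t) →
    codegProfile K b (S rs (2 * t)) ≡ sumRange (suc t) m N-even + (S rs (2 * t) ∸ 2) C k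
  codegProfile-evenRunEnd m len≤2m zero _ 1≤a = ⊥-elim (¬1≤at-zero rs 1≤a)
  codegProfile-evenRunEnd m len≤2m (suc t) t<m 1≤a = begin
    codegProfile K b (S rs (2 * suc t))                 ≡⟨ codegProfile-on K b on ⟩
    top + codegAbove K b (S rs (2 * suc t))             ≡⟨ cong (λ s → top + s) (codegAbove-skipZeroRun (suc t)) ⟩
    top + codegAbove K b (S rs (suc (2 * suc t)))       ≡⟨ cong (λ s → top + s) (sym (codegAboveOddRun-suc (suc t))) ⟩
    top + codegAboveOddRun (suc (suc t))
      ≡⟨ cong (λ s → top + s) (codegAboveOddRun≡sumRange m len≤2m (suc (suc t)) (s≤s t<m)) ⟩
    top + sumRange (suc (suc t)) m N-even               ≡⟨ +-comm top _ ⟩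
    sumRange (suc (suc t)) m N-even + top               ∎
    where
    open ≡-Reasoning
    top : ℕ
    top = (S rs (2 * suc t) ∸ 2) C k
    on : bAt b (S rs (2 * suc t)) ≡ true
    on = begin
      bAt b (S rs (2 * suc t))           ≡⟨ cong (bAt b ∘ S rs) (2*-suc t) ⟩
      bAt b (S rs (suc (suc (2 * t))))   ≡⟨ bAt-runEnd (suc (2 * t)) (subst (λ i → 1 ≤ at rs i) (2*-suc t) 1≤a) ⟩
      runColour true (2 * t)             ≡⟨ runColour-double true t ⟩
      true                               ∎

  run-eigenvalue : ∀ i → 2 ≤ at rs i →
    EigenvalueWithMultAtLeast (adjMatrix K b) (- + codegProfile K b (S rs i)) (at rs i ∸ 1)
  run-eigenvalue zero 2≤a = ⊥-elim (¬1≤at-zero rs (≤-trans (s≤s z≤n) 2≤a))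
  run-eigenvalue (suc j) 2≤a =
    maxProfile-eigenvalue (adjMatrix-isMaxProfile k b) (S rs j) (at rs (suc j)) 2≤a (S≤n (suc j)) step
    where
    step : ∀ z → S rs j < z → z < S rs (suc j) → 2 ≤ z → codegProfile K b z ≡ codegProfile K b (suc z)
    step z Sj<z z<S1+j 2≤z = codegProfile-step-inRun k b z 2≤z (<-≤-trans z<S1+j (S≤n (suc j)))
      (trans (bAt-run j z Sj<z (<⇒≤ z<S1+j)) (sym (bAt-run j (suc z) (m<n⇒m<1+n Sj<z) z<S1+j)))

  oddRun-eigenvalue : ∀ m → length rs ≤ 2 * m → ∀ t → 1 ≤ t → 2 * t ∸ 1 ≤ length rs → 2 ≤ at rs (2 * t ∸ 1) →
    EigenvalueWithMultAtLeast (adjMatrix K b) (- + sumRange t m N-even) (at rs (2 * t ∸ 1) ∸ 1)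
  oddRun-eigenvalue m len≤2m t@(suc t′) _ bound 2≤a =
    subst (λ V → EigenvalueWithMultAtLeast (adjMatrix K b) (- + V) (at rs (2 * t ∸ 1) ∸ 1))
          (codegProfile-oddRunEnd m len≤2m t t≤1+m (≤-trans (s≤s z≤n) 2≤a))
          (run-eigenvalue (2 * t ∸ 1) 2≤a)
    where
    t≤1+m : t ≤ suc m
    t≤1+m = s≤s (<⇒≤ (*-cancelˡ-< 2 t′ m (subst (_≤ 2 * m) (cong (_∸ 1) (2*-suc t′)) (≤-trans bound len≤2m))))

  evenRun-eigenvalue : ∀ m → length rs ≤ 2 * m → ∀ t → 1 ≤ t → 2 * t ≤ length rs → 2 ≤ at rs (2 * t) →
    EigenvalueWithMultAtLeast (adjMatrix K b) (- + (sumRange (suc t) m N-even + (S rs (2 * t) ∸ 2) C k)) (at rs (2 * t) ∸ 1)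
  evenRun-eigenvalue m len≤2m t _ bound 2≤a =
    subst (λ V → EigenvalueWithMultAtLeast (adjMatrix K b) (- + V) (at rs (2 * t) ∸ 1))
          (codegProfile-evenRunEnd m len≤2m t (*-cancelˡ-≤ 2 (≤-trans bound len≤2m)) (≤-trans (s≤s z≤n) 2≤a))
          (run-eigenvalue (2 * t) 2≤a)

  length-even : All (1 ≤_) rs → bAt b n ≡ true → ∃[ M ] length rs ≡ 2 * M
  length-even positive top with length rs in len
  ... | zero = 0 , refl
  ... | suc j = runColour-false≡true j (begin
    runColour false j           ≡⟨ sym (bAt-runEnd j (All-at positive j (≤-reflexive (sym len)))) ⟩
    bAt b (S rs (suc j))        ≡⟨ cong (bAt b ∘ S rs) (sym len) ⟩
    bAt b (S rs (length rs))    ≡⟨ cong (bAt b) S-total ⟩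
    bAt b n                     ≡⟨ top ⟩
    true                        ∎)
    where open ≡-Reasoning

  K≤n : bAt b K ≡ true → K ≤ n
  K≤n on = ≮⇒≥ (λ n<K → case trans (sym (bAt-beyond b K n<K)) on of λ ())

  firstRun<K : bAt b K ≡ true → S rs 1 < K
  firstRun<K on = ≰⇒> (λ K≤S₁ → case trans (sym (bAt-run 0 K (s≤s z≤n) K≤S₁)) on of λ ())

threshold-runs : ∀ k {n} (b : Vec Bool n) rs → toList b ≡ fromRuns false rs → All (1 ≤_) rs →
  (∀ i → 1 ≤ i → i < suc (suc k) → bAt b i ≡ false) → bAt b (suc (suc k)) ≡ true →
  ∃[ y ] ∃[ rest ] rs ≡ suc k ∷ y ∷ rest × 1 ≤ y
threshold-runs k b [] b≡rs _ _ on = ⊥-elim (<⇒≱ (s≤s z≤n) (subst (suc (suc k) ≤_) (sym S-total) (K≤n on)))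
  where open RunDecomposition k b [] b≡rs
threshold-runs k b (x ∷ []) b≡rs _ _ on = ⊥-elim (<⇒≱ (firstRun<K on) (subst (suc (suc k) ≤_) (sym S-total) (K≤n on)))
  where open RunDecomposition k b (x ∷ []) b≡rs
threshold-runs k b (x ∷ y ∷ rest) b≡rs (_ ∷ 1≤y ∷ _) below on with m≤n⇒m<n∨m≡n (s≤s⁻¹ (firstRun<K on))
  where open RunDecomposition k b (x ∷ y ∷ rest) b≡rs
... | inj₂ refl = y , rest , refl , 1≤y
... | inj₁ x<1+k =
  ⊥-elim (case trans (sym (below (suc x) (s≤s z≤n) (s≤s x<1+k))) (bAt-run 1 (suc x) ≤-refl x+1≤x+y) of λ ())
  where
  open RunDecomposition k b (x ∷ y ∷ rest) b≡rs
  x+1≤x+y : suc x ≤ x + y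
  x+1≤x+y = subst (_≤ x + y) (+-comm x 1) (+-monoʳ-≤ x 1≤y)

-- The case b_K = 1: the first run of ones starts at v_K, so the runs are (K - 1) ∷ y ∷ rest and the
-- short sequence is (K - 1 + y) ∷ rest.
module MergedRuns (k : ℕ) {n} (b : Vec Bool n) (y : ℕ) (rest : List ℕ)
       (b≡runs : toList b ≡ fromRuns false (suc k ∷ y ∷ rest)) (1≤y : 1 ≤ y) where

  open RunDecomposition k b (suc k ∷ y ∷ rest) b≡runs hiding (oddRun-eigenvalue; evenRun-eigenvalue)

  rs as : List ℕ
  rs = suc k ∷ y ∷ rest
  as = (suc k + y) ∷ rest

  at-merged : ∀ i → 2 ≤ i → at as i ≡ at rs (suc i)
  at-merged (suc (suc i)) _ = refl
  at-merged (suc zero) (s≤s ())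

  S-merged : ∀ i → 1 ≤ i → S as i ≡ S rs (suc i)
  S-merged (suc zero) _ = refl
  S-merged (suc (suc i)) _ = cong (_+ at rest (suc i)) (S-merged (suc i) (s≤s z≤n))

  N-odd : ℕ → ℕ
  N-odd ℓ = sumTo (at as (2 * ℓ ∸ 1)) (λ q → apexCount K (S as (2 * ℓ ∸ 2) + q))

  N-odd≡N-even : ∀ ℓ → 2 ≤ ℓ → N-odd ℓ ≡ N-even ℓ
  N-odd≡N-even (suc zero) (s≤s ())
  N-odd≡N-even (suc ℓ@(suc ℓ′)) _ = begin
    N-odd (suc ℓ)
      ≡⟨ cong₂ (λ i j → sumTo (at as i) (λ q → apexCount K (S as j + q))) (2*∸1-suc ℓ) (cong (_∸ 2) (2*-suc ℓ)) ⟩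
    sumTo (at rs (suc (suc (2 * ℓ)))) (λ q → apexCount K (S as (2 * ℓ) + q))
      ≡⟨ cong (λ s → sumTo (at rs (suc (suc (2 * ℓ)))) (λ q → apexCount K (s + q))) (S-merged (2 * ℓ) (s≤s z≤n)) ⟩
    sumTo (at rs (suc (suc (2 * ℓ)))) (λ q → apexCount K (S rs (suc (2 * ℓ)) + q))
      ≡⟨ sym (cong₂ (λ i j → sumTo (at rs i) (λ q → apexCount K (S rs j + q))) (2*-suc ℓ) (2*∸1-suc ℓ)) ⟩
    N-even (suc ℓ) ∎
    where open ≡-Reasoning

  merged-eigenvalue : EigenvalueWithMultAtLeast (adjMatrix K b) (- + codegProfile K b (suc k + y)) (suc k + y ∸ 1)
  merged-eigenvalue = maxProfile-eigenvalue (adjMatrix-isMaxProfile k b) 0 (suc k + y)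
    (s≤s (≤-trans 1≤y (m≤n+m y k))) (S≤n 2) step
    where
    step : ∀ z → 0 < z → z < suc k + y → 2 ≤ z → codegProfile K b z ≡ codegProfile K b (suc z)
    step z 0<z z<top 2≤z with <-cmp z (suc k)
    ... | tri< z<1+k _ _ = codegProfile-step-inRun k b z 2≤z (<-≤-trans z<top (S≤n 2))
      (trans (bAt-run 0 z 0<z (<⇒≤ z<1+k)) (sym (bAt-run 0 (suc z) (s≤s z≤n) z<1+k)))
    ... | tri> _ _ 1+k<z = codegProfile-step-inRun k b z 2≤z (<-≤-trans z<top (S≤n 2))
      (trans (bAt-run 1 z 1+k<z (<⇒≤ z<top)) (sym (bAt-run 1 (suc z) (m<n⇒m<1+n 1+k<z) z<top)))
    step (suc zero) _ _ (s≤s ()) | tri≈ _ refl _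
    step (suc (suc k′)) 0<z z<top 2≤z | tri≈ _ refl _ = codegProfile-step-threshold k′ b (<-≤-trans z<top (S≤n 2))
      (bAt-run 0 (suc (suc k′)) 0<z ≤-refl) (bAt-run 1 (suc (suc (suc k′))) ≤-refl z<top)

  length-rs≤ : ∀ m → 1 ≤ m → length as ≡ 2 * m ∸ 1 → length rs ≤ 2 * m
  length-rs≤ m 1≤m len = ≤-reflexive (trans (cong suc len) (suc-2*∸1 m 1≤m))

  sumRange-N-odd : ∀ t m → 1 ≤ t → sumRange (suc t) m N-even ≡ sumRange (suc t) m N-odd
  sumRange-N-odd t m 1≤t = sumRange-cong (suc t) m (λ ℓ t<ℓ → sym (N-odd≡N-even ℓ (≤-trans (s≤s 1≤t) t<ℓ)))

  shifted-eigenvalue : ∀ i → 2 ≤ i → 2 ≤ at as i →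
    EigenvalueWithMultAtLeast (adjMatrix K b) (- + codegProfile K b (S as i)) (at as i ∸ 1)
  shifted-eigenvalue i 2≤i 2≤a rewrite at-merged i 2≤i | S-merged i (≤-trans (s≤s z≤n) 2≤i) =
    run-eigenvalue (suc i) 2≤a

  oddRun-eigenvalue : ∀ m → 1 ≤ m → length as ≡ 2 * m ∸ 1 →
    ∀ t → 1 ≤ t → 2 * t ∸ 1 ≤ length as → 2 ≤ at as (2 * t ∸ 1) →
    EigenvalueWithMultAtLeast (adjMatrix K b) (- + (sumRange (suc t) m N-odd + (S as (2 * t ∸ 1) ∸ 2) C k))
                                              (at as (2 * t ∸ 1) ∸ 1)
  oddRun-eigenvalue m 1≤m len t 1≤t bound 2≤a =
    subst (λ V → EigenvalueWithMultAtLeast (adjMatrix K b) (- + V) (at as (2 * t ∸ 1) ∸ 1)) value (eigenvalue t 2≤a)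
    where
    S-as≡S-rs : S as (2 * t ∸ 1) ≡ S rs (2 * t)
    S-as≡S-rs = trans (S-merged (2 * t ∸ 1) (∸-monoˡ-≤ 1 (*-monoʳ-≤ 2 1≤t))) (cong (S rs) (suc-2*∸1 t 1≤t))
    t≤m : t ≤ m
    t≤m = *-cancelˡ-≤ 2 (subst₂ _≤_ (suc-2*∸1 t 1≤t) (suc-2*∸1 m 1≤m) (s≤s (subst (2 * t ∸ 1 ≤_) len bound)))
    1≤a-rs : ∀ t → 1 ≤ at as (2 * t ∸ 1) → 1 ≤ at rs (2 * t)
    1≤a-rs (suc zero) _ = 1≤y
    1≤a-rs t@(suc (suc _)) 1≤a =
      subst (1 ≤_) (trans (at-merged (2 * t ∸ 1) (2≤2*∸1 t (s≤s (s≤s z≤n))))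
                          (cong (at rs) (suc-2*∸1 t (s≤s z≤n)))) 1≤a
    value : codegProfile K b (S as (2 * t ∸ 1)) ≡ sumRange (suc t) m N-odd + (S as (2 * t ∸ 1) ∸ 2) C k
    value = begin
      codegProfile K b (S as (2 * t ∸ 1))
        ≡⟨ cong (codegProfile K b) S-as≡S-rs ⟩
      codegProfile K b (S rs (2 * t))
        ≡⟨ codegProfile-evenRunEnd m (length-rs≤ m 1≤m len) t t≤m (1≤a-rs t (≤-trans (s≤s z≤n) 2≤a)) ⟩
      sumRange (suc t) m N-even + (S rs (2 * t) ∸ 2) C k
        ≡⟨ cong₂ (λ x s → x + (s ∸ 2) C k) (sumRange-N-odd t m 1≤t) (sym S-as≡S-rs) ⟩
      sumRange (suc t) m N-odd + (S as (2 * t ∸ 1) ∸ 2) C k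
        ∎
      where open ≡-Reasoning
    eigenvalue : ∀ t → 2 ≤ at as (2 * t ∸ 1) →
      EigenvalueWithMultAtLeast (adjMatrix K b) (- + codegProfile K b (S as (2 * t ∸ 1))) (at as (2 * t ∸ 1) ∸ 1)
    eigenvalue (suc zero) _ = merged-eigenvalue
    eigenvalue t@(suc (suc _)) 2≤a = shifted-eigenvalue (2 * t ∸ 1) (2≤2*∸1 t (s≤s (s≤s z≤n))) 2≤a

  evenRun-eigenvalue : ∀ m → 1 ≤ m → length as ≡ 2 * m ∸ 1 →
    ∀ t → 1 ≤ t → 2 * t ≤ length as → 2 ≤ at as (2 * t) →
    EigenvalueWithMultAtLeast (adjMatrix K b) (- + sumRange (suc t) m N-odd) (at as (2 * t) ∸ 1)
  evenRun-eigenvalue m 1≤m len t 1≤t bound 2≤a =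
    subst (λ V → EigenvalueWithMultAtLeast (adjMatrix K b) (- + V) (at as (2 * t) ∸ 1)) value
          (shifted-eigenvalue (2 * t) 2≤2t 2≤a)
    where
    2≤2t : 2 ≤ 2 * t
    2≤2t = *-monoʳ-≤ 2 1≤t
    S-as≡S-rs : S as (2 * t) ≡ S rs (2 * suc t ∸ 1)
    S-as≡S-rs = trans (S-merged (2 * t) (≤-trans (s≤s z≤n) 2≤2t)) (cong (S rs) (sym (2*∸1-suc t)))
    t≤m : t ≤ m
    t≤m = *-cancelˡ-≤ 2 (≤-trans bound (≤-trans (≤-reflexive len) (m∸n≤m (2 * m) 1)))
    1≤a-rs : 1 ≤ at rs (2 * suc t ∸ 1)
    1≤a-rs = subst (1 ≤_) (trans (at-merged (2 * t) 2≤2t) (cong (at rs) (sym (2*∸1-suc t)))) (≤-trans (s≤s z≤n) 2≤a)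
    value : codegProfile K b (S as (2 * t)) ≡ sumRange (suc t) m N-odd
    value = begin
      codegProfile K b (S as (2 * t))
        ≡⟨ cong (codegProfile K b) S-as≡S-rs ⟩
      codegProfile K b (S rs (2 * suc t ∸ 1))
        ≡⟨ codegProfile-oddRunEnd m (length-rs≤ m 1≤m len) (suc t) (s≤s t≤m) 1≤a-rs ⟩
      sumRange (suc t) m N-even
        ≡⟨ sumRange-N-odd t m 1≤t ⟩
      sumRange (suc t) m N-odd ∎
      where open ≡-Reasoning

theorem2 : (k n : ℕ) (b : Vec Bool n) → 2 ≤ k →
  (∀ i → 1 ≤ i → i < k → bAt b i ≡ false) →
  bAt b n ≡ true →
  Connected k b →
  let as = shortSeq k b
      r = length as
      A = adjMatrix k b
      a = at as
      s = S as
      N-even = λ ℓ → sumTo (a (2 * ℓ)) (λ i → choose (s (2 * ℓ ∸ 1) + i ∸ 3) (+ k - + 3))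
      N-odd = λ ℓ → sumTo (a (2 * ℓ ∸ 1)) (λ i → choose (s (2 * ℓ ∸ 2) + i ∸ 3) (+ k - + 3))
  in (∀ m → r ≡ 2 * m →
        (∀ t → 1 ≤ t → 2 * t ∸ 1 ≤ r → 2 ≤ a (2 * t ∸ 1) →
           EigenvalueWithMultAtLeast A
             (- + sumRange t m N-even)
             (a (2 * t ∸ 1) ∸ 1))
      × (∀ t → 1 ≤ t → 2 * t ≤ r → 2 ≤ a (2 * t) →
           EigenvalueWithMultAtLeast A
             (- + (sumRange (suc t) m N-even + (s (2 * t) ∸ 2) C (k ∸ 2)))
             (a (2 * t) ∸ 1)))
   × (∀ m → 1 ≤ m → r ≡ 2 * m ∸ 1 →
        (∀ t → 1 ≤ t → 2 * t ∸ 1 ≤ r → 2 ≤ a (2 * t ∸ 1) →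
           EigenvalueWithMultAtLeast A
             (- + (sumRange (suc t) m N-odd + (s (2 * t ∸ 1) ∸ 2) C (k ∸ 2)))
             (a (2 * t ∸ 1) ∸ 1))
      × (∀ t → 1 ≤ t → 2 * t ≤ r → 2 ≤ a (2 * t) →
           EigenvalueWithMultAtLeast A
             (- + sumRange (suc t) m N-odd)
             (a (2 * t) ∸ 1)))
theorem2 zero _ _ () _ _ _
theorem2 (suc zero) _ _ (s≤s ()) _ _ _
theorem2 (suc (suc k)) n b _ below top _
  with runs (toList b) | runs-fromRuns b (below 1 (s≤s z≤n) (s≤s (s≤s z≤n))) | runs-positive (toList b)
... | rs | b≡rs | positive with RunDecomposition.length-even k b rs b≡rs positive top | bAt b (suc (suc k)) in bK
... | M , 2M | false =
  (λ m len → Runs.oddRun-eigenvalue m (≤-reflexive len) , Runs.evenRun-eigenvalue m (≤-reflexive len)) ,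
  λ { (suc m) _ len → ⊥-elim (2*≢1+2* M m (trans (sym 2M) (trans len (2*∸1-suc m)))) }
  where module Runs = RunDecomposition k b rs b≡rs
... | M , 2M | true with threshold-runs k b rs b≡rs positive below bK
... | y , rest , refl , 1≤y =
  (λ m len → ⊥-elim (2*≢1+2* M m (trans (sym 2M) (cong suc len)))) ,
  λ m 1≤m len → Merged.oddRun-eigenvalue m 1≤m len , Merged.evenRun-eigenvalue m 1≤m len
  where module Merged = MergedRuns k b y rest b≡rs 1≤y
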